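{- Let $q$ be an odd prime power. Then there is a semi-resolving set of size $5q-4$ for the lines of $W(q)$ which contains exactly $q-3$ points, all incident with the same line.
   Context: A null polarity $\pi$ of $\mathrm{PG}(3,q)$ is a polarity (an incidence-reversing involutory correspondence between points and planes, inducing an involution on lines) such that every point $P$ lies in its image plane $P^\pi$; a line $\ell$ is self-conjugate if $\ell^\pi=\ell$. $W(q)$ is the generalized quadrangle whose points are all points of $\mathrm{PG}(3,q)$ and whose lines are the self-conjugate lines of a null polarity, with inherited incidence. A semi-resolving set for the lines is a set $S$ of vertices of the incidence graph (bipartite graph on points and lines, adjacency = incidence) such that any two distinct lines $\ell\neq\ell'$ have some $x\in S$ with $d(\ell,x)\neq d(\ell',x)$, where $d$ is graph distance. -}

module Defs where

open import Level using (0ℓ)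
open import Data.Nat using (ℕ; zero; suc; _<_; _^_)
open import Data.Nat.Primality using (Prime)
open import Data.Nat.Divisibility using (_∣_)
open import Data.Fin using (Fin)
import Data.Fin as Fin
import Data.Empty
open import Data.Product using (Σ; ∃; _×_; _,_; ∃-syntax)
open import Data.Sum using (_⊎_; inj₁; inj₂)
open import Data.List using (List; length; filter; mapMaybe)
open import Data.List.Membership.Propositional using (_∈_)
open import Data.List.Relation.Unary.Unique.Propositional using (Unique)
open import Data.List.Relation.Unary.All using (All)
open import Data.List.Relation.Unary.AllPairs using (AllPairs)
open import Data.Maybe using (Maybe; just; nothing)
open import Relation.Nullary using (¬_; Dec)
open import Relation.Binary.PropositionalEquality using (_≡_; _≢_)
open import Algebra.Structures using (IsCommutativeRing)
open import Function.Bundles using (_⇔_)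

OddPrimePower : ℕ → Set
OddPrimePower q = ∃[ p ] ∃[ k ] (Prime p × ¬ (2 ∣ p) × q ≡ p ^ suc k)

record FiniteField : Set₁ where
  infixl 7 _*_
  infixl 6 _+_
  field
    Carrier  : Set
    _≟_      : (x y : Carrier) → Dec (x ≡ y)
    _+_ _*_  : Carrier → Carrier → Carrier
    -_       : Carrier → Carrier
    0# 1#    : Carrier
    _⁻¹      : Carrier → Carrier
    isCommutativeRing : IsCommutativeRing _≡_ _+_ _*_ -_ 0# 1#
    0≢1      : 0# ≢ 1#
    ⁻¹-inverse : ∀ x → x ≢ 0# → x * (x ⁻¹) ≡ 1#
    elements : List Carrier
    elements-unique   : Unique elements
    elements-complete : ∀ x → x ∈ elements

  order : ℕ
  order = length elements

-- The generalized quadrangle W(q) over a finite field F: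
-- points of PG(3,F) (nonzero vectors of F⁴ up to nonzero scalars) and
-- the lines of PG(3,F) that are self-conjugate (totally isotropic)
-- for the null polarity given by the standard alternating form
--   B(x,y) = x₀y₁ - x₁y₀ + x₂y₃ - x₃y₂ .

module W (F : FiniteField) where
  open FiniteField F

  Vec4 : Set
  Vec4 = Fin 4 → Carrier

  f0 f1 f2 f3 : Fin 4
  f0 = Fin.zero
  f1 = Fin.suc Fin.zero
  f2 = Fin.suc (Fin.suc Fin.zero)
  f3 = Fin.suc (Fin.suc (Fin.suc Fin.zero))

  B : Vec4 → Vec4 → Carrier
  B x y = ((x f0 * y f1 + - (x f1 * y f0)) + x f2 * y f3) + - (x f3 * y f2)

  record Point : Set where
    constructor point
    field
      vec     : Vec4
      nonzero : ∃[ i ] (vec i ≢ 0#)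

  _≈P_ : Point → Point → Set
  P ≈P Q = ∃[ c ] (c ≢ 0# × ∀ i → Point.vec P i ≡ c * Point.vec Q i)

  record Line : Set where
    constructor line
    field
      u v         : Vec4
      independent : ∀ a b → (∀ i → a * u i + b * v i ≡ 0#) → (a ≡ 0# × b ≡ 0#)
      isotropic   : B u v ≡ 0#

  InSpan : Vec4 → Line → Set
  InSpan w L = ∃[ a ] ∃[ b ] (∀ i → w i ≡ a * Line.u L i + b * Line.v L i)

  _≈L_ : Line → Line → Set
  L ≈L M = ∀ w → InSpan w L ⇔ InSpan w M

  _I_ : Point → Line → Set
  P I L = InSpan (Point.vec P) L

  Vertex : Set
  Vertex = Point ⊎ Line

  _≈V_ : Vertex → Vertex → Set
  inj₁ P ≈V inj₁ Q = P ≈P Q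
  inj₁ P ≈V inj₂ M = Data.Empty.⊥
  inj₂ L ≈V inj₁ Q = Data.Empty.⊥
  inj₂ L ≈V inj₂ M = L ≈L M

  Adj : Vertex → Vertex → Set
  Adj (inj₁ P) (inj₁ Q) = Data.Empty.⊥
  Adj (inj₁ P) (inj₂ M) = P I M
  Adj (inj₂ L) (inj₁ Q) = Q I L
  Adj (inj₂ L) (inj₂ M) = Data.Empty.⊥

  Walk : ℕ → Vertex → Vertex → Set
  Walk zero    x y = x ≈V y
  Walk (suc n) x y = ∃[ z ] (Adj x z × Walk n z y)

  Dist : Vertex → Vertex → ℕ → Set
  Dist x y n = Walk n x y × (∀ m → m < n → ¬ Walk m x y)

  -- d(x,z) ≠ d(y,z)  (as values in ℕ ∪ {∞})
  Distinguishes : Vertex → Vertex → Vertex → Set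
  Distinguishes z x y =
    (∃[ n ] (Dist x z n × ¬ Dist y z n)) ⊎ (∃[ n ] (Dist y z n × ¬ Dist x z n))

  SemiResolvingForLines : List Vertex → Set
  SemiResolvingForLines S =
    ∀ (ℓ ℓ′ : Line) → ¬ (ℓ ≈L ℓ′) →
      ∃[ x ] (x ∈ S × Distinguishes x (inj₂ ℓ) (inj₂ ℓ′))

  pointsOf : List Vertex → List Point
  pointsOf = mapMaybe isPoint
    where
    isPoint : Vertex → Maybe Point
    isPoint (inj₁ P) = just P
    isPoint (inj₂ _) = nothing

  -- S lists pairwise distinct vertices (so its size is its length)
  Distinct : List Vertex → Set
  Distinct = AllPairs (λ x y → ¬ (x ≈V y))

-- The set S consists of the 4q − 1 lines L₀ t, L₂ t, Lʸ t (t ∈ F) and L₁ t (t ≠ 0) of W(q), and the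
-- q − 3 points e₀ + t e₂ (t ∉ {0, 1, 2}) of the line L₀ 0. Two lines at equal distances from all
-- vertices of S meet the same lines of S and contain the same points of S. In Plücker coordinates
-- p_ij, a line ℓ meets L₀ t, L₁ t, L₂ t, Lʸ t iff Klein's form vanishes, a linear condition in t whose
-- root is a ratio of coordinates of ℓ: p₁₃ : p₁₂, p₀₃ : p₀₂, p₀₃ : p₁₃ and (p₀₁ − p₂₃ + p₀₃ + p₁₂) : p₁₃.
-- If p₁₃ ≠ 0, these ratios, the isotropy relation p₀₁ + p₂₃ = 0 and the Klein relation determine ℓ,
-- dividing by 2 since q is odd. If p₁₃ = 0 (ℓ meets L₀ 0), then ℓ lies in S, is the line e₀e₃, or
-- passes through e₀ + t e₂ with t ∉ {0, 1}; there the points of S fix t and the lines L₁ fix p₀₂ : p₀₃.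

module Submission where

open import Defs
open import Algebra.Bundles using (CommutativeRing; RawRing)
open import Algebra.Core using (Op₁; Op₂)
import Algebra.Solver.Ring.AlmostCommutativeRing as ACR
open import Data.Empty using (⊥; ⊥-elim)
open import Data.Fin using (Fin)
import Data.Fin as Fin
open import Data.Fin.Patterns using (0F; 1F; 2F; 3F)
open import Data.Fin.Properties using (all?; ¬∀⟶∃¬)
open import Data.List using (List; []; _∷_; _++_; map; filter; length)
open import Data.List.Membership.Propositional using (_∈_; find; lose)
open import Data.List.Membership.Propositional.Properties using (∈-filter⁺; ∈-filter⁻; ∈-map⁺; ∈-++⁺ˡ; ∈-++⁺ʳ)
open import Data.List.Properties using (filter-accept; filter-reject; filter-all; length-++; length-map)
open import Data.List.Relation.Unary.All as All using (All)
import Data.List.Relation.Unary.All.Properties as Allₚ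
open import Data.List.Relation.Unary.AllPairs as AllPairs using (AllPairs; _∷_)
import Data.List.Relation.Unary.AllPairs.Properties as AllPairsₚ
open import Data.List.Relation.Unary.Any using (Any; any?; here; there)
open import Data.List.Relation.Unary.Unique.Propositional using (Unique)
import Data.List.Relation.Unary.Unique.Propositional.Properties as Uniqueₚ
open import Data.Maybe using (Maybe; just; nothing)
open import Data.Nat as ℕ using (ℕ; zero; suc; _^_; _∸_)
open import Data.Nat.Divisibility using (_∣_; _∣0; ∣-refl; ∣m∣n⇒∣m+n; ∣1⇒≡1)
open import Data.Nat.Primality using (euclidsLemma; prime[2])
import Data.Nat.Properties as ℕₚ
open import Data.Nat.Tactic.RingSolver using (solve-∀)
open import Data.Product using (∃; ∃-syntax; _×_; _,_; proj₁; proj₂)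
open import Data.Sum using (_⊎_; inj₁; inj₂; [_,_]′)
import Data.Sum as Sum
open import Data.Vec.N-ary using (N-ary)
open import Function using (_∘_; case_of_)
open import Function.Bundles using (_⇔_; mk⇔; Equivalence)
open import Function.Properties.Equivalence using (⇔-isEquivalence)
open import Relation.Binary.Definitions using (DecidableEquality)
open import Relation.Binary.PropositionalEquality
open import Relation.Binary.Structures using (IsEquivalence)
open import Relation.Nullary using (¬_; Dec; yes; no)
open import Relation.Nullary.Decidable using (map′; ¬?; _×-dec_; _⊎-dec_; True; toWitness)

open Equivalence using (to; from)

vec4 : ∀ {a} {A : Set a} → A → A → A → A → Fin 4 → A
vec4 a b c d 0F = a
vec4 a b c d 1F = b
vec4 a b c d 2F = c
vec4 a b c d 3F = d

-- Exterior-algebra coordinates over any carrier with +, * and −, so that the same expressions denote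
-- field elements and ring-solver polynomials.
module Exterior {a} {A : Set a} (_⊕_ _⊗_ : Op₂ A) (⊖_ : Op₁ A) where
  _⊝_ : Op₂ A
  x ⊝ y = x ⊕ (⊖ y)

  lin : A → A → (Fin 4 → A) → (Fin 4 → A) → Fin 4 → A
  lin a b x y i = (a ⊗ x i) ⊕ (b ⊗ y i)

  plücker : (Fin 4 → A) → (Fin 4 → A) → Fin 4 → Fin 4 → A
  plücker x y i j = (x i ⊗ y j) ⊝ (x j ⊗ y i)

  wedge : (Fin 4 → Fin 4 → A) → (Fin 4 → A) → Fin 4 → Fin 4 → Fin 4 → A
  wedge p w i j k = ((w k ⊗ p i j) ⊝ (w j ⊗ p i k)) ⊕ (w i ⊗ p j k)

  klein : (Fin 4 → Fin 4 → A) → (Fin 4 → Fin 4 → A) → A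
  klein p q = (((((p 0F 1F ⊗ q 2F 3F) ⊕ (p 2F 3F ⊗ q 0F 1F)) ⊝ (p 0F 2F ⊗ q 1F 3F)) ⊝ (p 1F 3F ⊗ q 0F 2F))
                ⊕ (p 0F 3F ⊗ q 1F 2F)) ⊕ (p 1F 2F ⊗ q 0F 3F)

module Removal {a} {A : Set a} (_≟_ : DecidableEquality A) where
  without : A → List A → List A
  without x = filter (λ y → ¬? (y ≟ x))

  ∈-without⁺ : ∀ {x y xs} → y ∈ xs → y ≢ x → y ∈ without x xs
  ∈-without⁺ {x} = ∈-filter⁺ (λ y → ¬? (y ≟ x))

  ∈-without⁻ : ∀ {x y} xs → y ∈ without x xs → y ∈ xs × y ≢ x
  ∈-without⁻ {x} xs = ∈-filter⁻ (λ y → ¬? (y ≟ x)) {xs = xs}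

  without-unique : ∀ {x xs} → Unique xs → Unique (without x xs)
  without-unique {x} = Uniqueₚ.filter⁺ (λ y → ¬? (y ≟ x))

  length-without : ∀ {x xs} → Unique xs → x ∈ xs → suc (length (without x xs)) ≡ length xs
  length-without {x} {x ∷ ys} (x∉ys ∷ _) (here refl) =
    cong suc (trans (cong length (trans (filter-reject (λ y → ¬? (y ≟ x)) (λ x≢x → x≢x refl))
                                        (filter-all (λ y → ¬? (y ≟ x)) (All.map (λ x≢y y≡x → x≢y (sym y≡x)) x∉ys))))
                    refl)
  length-without {x} {y ∷ ys} (y∉ys ∷ unique) (there x∈ys) =
    trans (cong (suc ∘ length) (filter-accept (λ y → ¬? (y ≟ x)) (All.lookup y∉ys x∈ys)))
          (cong suc (length-without unique x∈ys))

  module _ (σ : A → A) (σ-involutive : ∀ x → σ (σ x) ≡ x) (σ-fixpointFree : ∀ x → σ x ≢ x) where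
    involution-even : ∀ n xs → length xs ≡ n → Unique xs → (∀ {x} → x ∈ xs → σ x ∈ xs) → 2 ∣ n
    involution-even zero [] refl _ _ = 2 ∣0
    involution-even (suc n) (x ∷ ys) |x∷ys|≡1+n (x∉ys ∷ unique′) closed =
      step n (trans (length-without unique′ σx∈ys) (ℕₚ.suc-injective |x∷ys|≡1+n))
      where
      σx∈ys : σ x ∈ ys
      σx∈ys with closed (here refl)
      ... | here σx≡x = ⊥-elim (σ-fixpointFree x σx≡x)
      ... | there σx∈ys = σx∈ys
      zs : List A
      zs = without (σ x) ys
      closed′ : ∀ {y} → y ∈ zs → σ y ∈ zs
      closed′ {y} y∈zs with ∈-without⁻ ys y∈zs
      ... | y∈ys , y≢σx with closed (there y∈ys)
      ...   | here σy≡x = ⊥-elim (y≢σx (trans (sym (σ-involutive y)) (cong σ σy≡x)))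
      ...   | there σy∈ys = ∈-without⁺ σy∈ys λ σy≡σx →
        All.lookup x∉ys y∈ys (trans (sym (σ-involutive x)) (trans (cong σ (sym σy≡σx)) (σ-involutive y)))
      step : ∀ m → suc (length zs) ≡ m → 2 ∣ suc m
      step (suc m) |zs|≡m = ∣m∣n⇒∣m+n (∣-refl {2}) (involution-even m zs (ℕₚ.suc-injective |zs|≡m) (without-unique unique′) closed′)

¬2∣odd^ : ∀ {p} → ¬ (2 ∣ p) → ∀ k → ¬ (2 ∣ p ^ k)
¬2∣odd^ ¬2∣p zero 2∣1 = case ∣1⇒≡1 2∣1 of λ ()
¬2∣odd^ {p} ¬2∣p (suc k) 2∣p^k+1 = [ ¬2∣p , ¬2∣odd^ ¬2∣p k ]′ (euclidsLemma p (p ^ k) prime[2] 2∣p^k+1)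

module FieldTheory (F : FiniteField) where
  open FiniteField F public
  open Exterior _+_ _*_ -_ public

  commutativeRing : CommutativeRing _ _
  commutativeRing = record { isCommutativeRing = isCommutativeRing }

  open CommutativeRing commutativeRing public
    using (_-_; +-assoc; +-comm; *-assoc; *-comm; +-identityˡ; +-identityʳ; *-identityˡ; *-identityʳ;
           distribˡ; distribʳ; -‿inverseˡ; -‿inverseʳ; zeroˡ; zeroʳ; ring; semiring; +-commutativeSemigroup)
  open import Algebra.Properties.Ring ring public
    using (-‿distribˡ-*; -‿distribʳ-*; -‿+-comm; -‿involutive; -0#≈0#; +-cancelʳ; x∙y⁻¹≈ε⇒x≈y; x≈y⇒x∙y⁻¹≈ε; ⁻¹-anti-homo‿-)
  open import Algebra.Properties.CommutativeSemigroup +-commutativeSemigroup public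
    using () renaming (interchange to +-interchange)

  difference-+ : ∀ a b c d → (a + c) - (b + d) ≡ (a - b) + (c - d)
  difference-+ a b c d = trans (cong ((a + c) +_) (sym (-‿+-comm b d))) (+-interchange a c (- b) (- d))

  difference-* : ∀ a b c d → (a - b) * (c - d) ≡ (a * c + b * d) - (a * d + b * c)
  difference-* a b c d = begin
    (a - b) * (c - d)                             ≡⟨ distribʳ (c - d) a (- b) ⟩
    a * (c - d) + - b * (c - d)                   ≡⟨ cong₂ _+_ (distribˡ a c (- d)) (distribˡ (- b) c (- d)) ⟩
    (a * c + a * - d) + (- b * c + - b * - d)     ≡⟨ cong₂ (λ x y → (a * c + x) + (y + - b * - d)) (sym (-‿distribʳ-* a d)) (sym (-‿distribˡ-* b c)) ⟩
    (a * c - a * d) + (- (b * c) + - b * - d)     ≡⟨ cong (λ x → (a * c - a * d) + (- (b * c) + x)) neg-neg ⟩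
    (a * c - a * d) + (- (b * c) + b * d)         ≡⟨ cong ((a * c - a * d) +_) (+-comm _ _) ⟩
    (a * c - a * d) + (b * d - b * c)             ≡⟨ +-interchange _ _ _ _ ⟩
    (a * c + b * d) + (- (a * d) + - (b * c))     ≡⟨ cong ((a * c + b * d) +_) (-‿+-comm _ _) ⟩
    (a * c + b * d) - (a * d + b * c)             ∎
    where
    open ≡-Reasoning
    neg-neg : - b * - d ≡ b * d
    neg-neg = trans (sym (-‿distribˡ-* b (- d))) (trans (cong -_ (sym (-‿distribʳ-* b d))) (-‿involutive (b * d)))

  difference-cong : ∀ a b c d → a + d ≡ c + b → a - b ≡ c - d
  difference-cong a b c d e = +-cancelʳ (b + d) (a - b) (c - d) (begin
    (a - b) + (b + d)     ≡⟨ +-interchange a (- b) b d ⟩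
    (a + b) + (- b + d)   ≡⟨ cong ((a + b) +_) (+-comm (- b) d) ⟩
    (a + b) + (d - b)     ≡⟨ +-interchange a b d (- b) ⟩
    (a + d) + (b - b)     ≡⟨ cong₂ _+_ e (-‿inverseʳ b) ⟩
    (c + b) + 0#          ≡⟨ cong ((c + b) +_) (sym (-‿inverseʳ d)) ⟩
    (c + b) + (d - d)     ≡⟨ +-interchange c b d (- d) ⟩
    (c + d) + (b - d)     ≡⟨ cong ((c + d) +_) (+-comm b (- d)) ⟩
    (c + d) + (- d + b)   ≡⟨ +-interchange c d (- d) b ⟩
    (c - d) + (d + b)     ≡⟨ cong ((c - d) +_) (+-comm d b) ⟩
    (c - d) + (b + d)     ∎)
    where open ≡-Reasoning

  -- Solver coefficients are pairs (m, n) standing for m − n; ⟦_⟧ sends (0, 0) and (1, 0) to 0# and 1#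
  -- on the nose, so that constants in solved equations match the ones in goals.
  module Solver where
    open import Algebra.Properties.Semiring.Mult.TCOptimised semiring using (×-homo-+; ×1-homo-*) renaming (_×_ to _×′_)

    coefficients : RawRing _ _
    coefficients = record
      { Carrier = ℕ × ℕ ; _≈_ = _≡_
      ; _+_ = λ (m , n) (m′ , n′) → (m ℕ.+ m′ , n ℕ.+ n′)
      ; _*_ = λ (m , n) (m′ , n′) → (m ℕ.* m′ ℕ.+ n ℕ.* n′ , m ℕ.* n′ ℕ.+ n ℕ.* m′)
      ; -_ = λ (m , n) → (n , m)
      ; 0# = (0 , 0) ; 1# = (1 , 0) }

    ⟦_⟧ : ℕ × ℕ → Carrier
    ⟦ m , zero ⟧ = m ×′ 1#
    ⟦ m , n@(suc _) ⟧ = m ×′ 1# - n ×′ 1#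

    ⟦⟧-difference : ∀ m n → ⟦ m , n ⟧ ≡ m ×′ 1# - n ×′ 1#
    ⟦⟧-difference m zero = sym (trans (cong (m ×′ 1# +_) -0#≈0#) (+-identityʳ _))
    ⟦⟧-difference m (suc n) = refl

    morphism : coefficients ACR.-Raw-AlmostCommutative⟶ ACR.fromCommutativeRing commutativeRing
    morphism = record
      { ⟦_⟧ = ⟦_⟧
      ; +-homo = λ (m , n) (m′ , n′) → trans (⟦⟧-difference (m ℕ.+ m′) (n ℕ.+ n′))
          (trans (cong₂ _-_ (×-homo-+ 1# m m′) (×-homo-+ 1# n n′))
          (trans (difference-+ _ _ _ _) (sym (cong₂ _+_ (⟦⟧-difference m n) (⟦⟧-difference m′ n′)))))
      ; *-homo = λ (m , n) (m′ , n′) → trans (⟦⟧-difference (m ℕ.* m′ ℕ.+ n ℕ.* n′) (m ℕ.* n′ ℕ.+ n ℕ.* m′))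
          (trans (cong₂ _-_ (trans (×-homo-+ 1# (m ℕ.* m′) (n ℕ.* n′)) (cong₂ _+_ (×1-homo-* m m′) (×1-homo-* n n′)))
                            (trans (×-homo-+ 1# (m ℕ.* n′) (n ℕ.* m′)) (cong₂ _+_ (×1-homo-* m n′) (×1-homo-* n m′))))
          (trans (sym (difference-* _ _ _ _)) (sym (cong₂ _*_ (⟦⟧-difference m n) (⟦⟧-difference m′ n′)))))
      ; -‿homo = λ (m , n) → trans (⟦⟧-difference n m)
          (trans (sym (⁻¹-anti-homo‿- _ _)) (cong -_ (sym (⟦⟧-difference m n))))
      ; 0-homo = refl
      ; 1-homo = refl
      }

    coefficient-≟ : (x y : ℕ × ℕ) → Maybe (⟦ x ⟧ ≡ ⟦ y ⟧)
    coefficient-≟ (m , n) (m′ , n′) with m ℕ.+ n′ ℕₚ.≟ m′ ℕ.+ n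
    ... | no _ = nothing
    ... | yes e = just (begin
      ⟦ m , n ⟧                ≡⟨ ⟦⟧-difference m n ⟩
      m ×′ 1# - n ×′ 1#        ≡⟨ difference-cong _ _ _ _ cross ⟩
      m′ ×′ 1# - n′ ×′ 1#      ≡⟨ sym (⟦⟧-difference m′ n′) ⟩
      ⟦ m′ , n′ ⟧              ∎)
      where
      open ≡-Reasoning
      cross : m ×′ 1# + n′ ×′ 1# ≡ m′ ×′ 1# + n ×′ 1#
      cross = trans (sym (×-homo-+ 1# m n′)) (trans (cong (_×′ 1#) e) (×-homo-+ 1# m′ n))

  open import Algebra.Solver.Ring Solver.coefficients (ACR.fromCommutativeRing commutativeRing) Solver.morphism Solver.coefficient-≟ public
    using (solve; _:=_; _:+_; _:*_; _:-_; :-_; con; Polynomial)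

  module Poly {n : ℕ} = Exterior {A = Polynomial n} _:+_ _:*_ :-_

  :0 :1 : ∀ {n} → Polynomial n
  :0 = con (0 , 0)
  :1 = con (1 , 0)

  1≢0 : 1# ≢ 0#
  1≢0 e = 0≢1 (sym e)

  x-y≡0⇒x≡y : ∀ {x y} → x - y ≡ 0# → x ≡ y
  x-y≡0⇒x≡y = x∙y⁻¹≈ε⇒x≈y _ _

  x≡y⇒x-y≡0 : ∀ {x y} → x ≡ y → x - y ≡ 0#
  x≡y⇒x-y≡0 = x≈y⇒x∙y⁻¹≈ε

  -x≡0⇒x≡0 : ∀ {x} → - x ≡ 0# → x ≡ 0#
  -x≡0⇒x≡0 {x} e = trans (sym (-‿involutive x)) (trans (cong -_ e) -0#≈0#)

  ⁻¹-inverseˡ : ∀ {x} → x ≢ 0# → x ⁻¹ * x ≡ 1#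
  ⁻¹-inverseˡ {x} x≢0 = trans (*-comm _ _) (⁻¹-inverse x x≢0)

  x*y≡0⇒y≡0 : ∀ {x y} → x ≢ 0# → x * y ≡ 0# → y ≡ 0#
  x*y≡0⇒y≡0 {x} {y} x≢0 e = begin
    y                ≡⟨ sym (*-identityˡ y) ⟩
    1# * y           ≡⟨ cong (_* y) (sym (⁻¹-inverseˡ x≢0)) ⟩
    (x ⁻¹ * x) * y   ≡⟨ *-assoc _ _ _ ⟩
    x ⁻¹ * (x * y)   ≡⟨ cong (x ⁻¹ *_) e ⟩
    x ⁻¹ * 0#        ≡⟨ zeroʳ _ ⟩
    0#               ∎
    where open ≡-Reasoning

  *-≢0 : ∀ {x y} → x ≢ 0# → y ≢ 0# → x * y ≢ 0#
  *-≢0 x≢0 y≢0 = y≢0 ∘ x*y≡0⇒y≡0 x≢0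

  ⁻¹-≢0 : ∀ {x} → x ≢ 0# → x ⁻¹ ≢ 0#
  ⁻¹-≢0 {x} x≢0 e = 0≢1 (trans (sym (zeroʳ x)) (trans (cong (x *_) (sym e)) (⁻¹-inverse x x≢0)))

  *-cancelˡ : ∀ {z x y} → z ≢ 0# → z * x ≡ z * y → x ≡ y
  *-cancelˡ {z} {x} {y} z≢0 e =
    x-y≡0⇒x≡y (x*y≡0⇒y≡0 z≢0 (trans (distribˡ z x (- y)) (trans (cong (z * x +_) (sym (-‿distribʳ-* z y))) (x≡y⇒x-y≡0 e))))

  x*x≡0⇒x≡0 : ∀ {x} → x * x ≡ 0# → x ≡ 0#
  x*x≡0⇒x≡0 {x} e with x ≟ 0#
  ... | yes x≡0 = x≡0
  ... | no x≢0 = x*y≡0⇒y≡0 x≢0 e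

  2# : Carrier
  2# = 1# + 1#

  *-vanish : ∀ {c x} → x ≡ 0# → c * x ≡ 0#
  *-vanish {c} refl = zeroʳ c

  *+-vanish : ∀ {c x r} → x ≡ 0# → r ≡ 0# → c * x + r ≡ 0#
  *+-vanish {c} refl refl = trans (+-identityʳ _) (zeroʳ c)

  lin-0ˡ : ∀ a b x → a * 0# + b * x ≡ b * x
  lin-0ˡ a b x = trans (cong (_+ b * x) (zeroʳ a)) (+-identityˡ _)

  lin-0ʳ : ∀ a b x → a * x + b * 0# ≡ a * x
  lin-0ʳ a b x = trans (cong (a * x +_) (zeroʳ b)) (+-identityʳ _)

  cross-multiply : ∀ {t x y x′ y′} → y ≡ t * x → y′ ≡ t * x′ → y * x′ ≡ y′ * x
  cross-multiply {t} {x} {x′ = x′} refl refl = solve 3 (λ t x x′ → t :* x :* x′ := t :* x′ :* x) refl t x x′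

  quotient-root : ∀ {x} y → x ≢ 0# → y ≡ y * x ⁻¹ * x
  quotient-root y x≢0 = sym (trans (*-assoc _ _ _) (trans (cong (y *_) (⁻¹-inverseˡ x≢0)) (*-identityʳ y)))

  root-transfer : ∀ {x y x′ y′} → x ≢ 0# → (∀ t → y ≡ t * x → y′ ≡ t * x′) → y * x′ ≡ y′ * x
  root-transfer {y = y} x≢0 transfer = cross-multiply (quotient-root y x≢0) (transfer _ (quotient-root y x≢0))

  nonzero-roots-agree : ∀ {x y x′ y′} → y ≢ 0# → y′ ≢ 0# →
    (∀ t → t ≢ 0# → y ≡ t * x → y′ ≡ t * x′) → (∀ t → t ≢ 0# → y′ ≡ t * x′ → y ≡ t * x) → y * x′ ≡ y′ * x
  nonzero-roots-agree {x} {y} {x′} {y′} y≢0 y′≢0 transfer transfer′ = case (x ≟ 0#) (x′ ≟ 0#)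
    where
    case : Dec (x ≡ 0#) → Dec (x′ ≡ 0#) → y * x′ ≡ y′ * x
    case (no x≢0) _ = cross-multiply (quotient-root y x≢0) (transfer _ (*-≢0 y≢0 (⁻¹-≢0 x≢0)) (quotient-root y x≢0))
    case (yes x≡0) (yes x′≡0) = trans (*-vanish x′≡0) (sym (*-vanish x≡0))
    case (yes x≡0) (no x′≢0) =
      ⊥-elim (y≢0 (trans (transfer′ _ (*-≢0 y′≢0 (⁻¹-≢0 x′≢0)) (quotient-root y′ x′≢0)) (*-vanish x≡0)))

  -- In characteristic 2, x ↦ x + 1 would pair off the elements of F.
  odd-order⇒2≢0 : OddPrimePower order → 2# ≢ 0#
  odd-order⇒2≢0 (p , k , _ , p-odd , q≡p^1+k) 2≡0 = ¬2∣odd^ p-odd (suc k) (subst (2 ∣_) q≡p^1+k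
    (involution-even (_+ 1#) +1-involutive +1-fixpointFree _ elements refl elements-unique (λ {x} _ → elements-complete (x + 1#))))
    where
    open Removal _≟_ using (involution-even)
    +1-involutive : ∀ x → x + 1# + 1# ≡ x
    +1-involutive x = trans (+-assoc x 1# 1#) (trans (cong (x +_) 2≡0) (+-identityʳ x))
    +1-fixpointFree : ∀ x → x + 1# ≢ x
    +1-fixpointFree x x+1≡x = 1≢0 (+-cancelʳ x 1# 0# (trans (+-comm 1# x) (trans x+1≡x (sym (+-identityˡ x)))))

module Lines (F : FiniteField) where
  open FieldTheory F
  open W F public

  private module ⇔ {ℓ} = IsEquivalence (⇔-isEquivalence {ℓ})

  coords : Line → Fin 4 → Fin 4 → Carrier
  coords L = plücker (Line.u L) (Line.v L)

  coords-diag : ∀ L i → coords L i i ≡ 0#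
  coords-diag L i = -‿inverseʳ _

  coords-antisym : ∀ L i j → coords L j i ≡ - coords L i j
  coords-antisym L i j = sym (⁻¹-anti-homo‿- (Line.u L i * Line.v L j) (Line.u L j * Line.v L i))

  coords≡0-flip : ∀ L {i j} → coords L i j ≡ 0# → coords L j i ≡ 0#
  coords≡0-flip L {i} {j} p≡0 = trans (coords-antisym L i j) (trans (cong -_ p≡0) -0#≈0#)

  fromSixPairs : ∀ {ℓ} (R : Fin 4 → Fin 4 → Set ℓ) → (∀ i → R i i) → (∀ {i j} → R i j → R j i) →
                 R 0F 1F → R 0F 2F → R 0F 3F → R 1F 2F → R 1F 3F → R 2F 3F → ∀ i j → R i j
  fromSixPairs R diag flip r01 r02 r03 r12 r13 r23 = go
    where
    go : ∀ i j → R i j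
    go 0F 0F = diag 0F
    go 0F 1F = r01
    go 0F 2F = r02
    go 0F 3F = r03
    go 1F 0F = flip r01
    go 1F 1F = diag 1F
    go 1F 2F = r12
    go 1F 3F = r13
    go 2F 0F = flip r02
    go 2F 1F = flip r12
    go 2F 2F = diag 2F
    go 2F 3F = r23
    go 3F 0F = flip r03
    go 3F 1F = flip r13
    go 3F 2F = flip r23
    go 3F 3F = diag 3F

  module _ (L : Line) where
    private
      u v : Vec4
      u = Line.u L
      v = Line.v L

    wedge-congʳ : ∀ {w w′} → (∀ k → w k ≡ w′ k) → ∀ i j k → wedge (coords L) w i j k ≡ wedge (coords L) w′ i j k
    wedge-congʳ e i j k =
      cong₂ _+_ (cong₂ _-_ (cong (_* coords L i j) (e k)) (cong (_* coords L i k) (e j))) (cong (_* coords L j k) (e i))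

    inSpan⇒wedge≡0 : ∀ {w} → InSpan w L → ∀ i j k → wedge (coords L) w i j k ≡ 0#
    inSpan⇒wedge≡0 (a , b , w≡) i j k = trans (wedge-congʳ w≡ i j k)
      (solve 8 (λ a b ui uj uk vi vj vk →
        (a :* uk :+ b :* vk) :* (ui :* vj :- uj :* vi) :- (a :* uj :+ b :* vj) :* (ui :* vk :- uk :* vi)
          :+ (a :* ui :+ b :* vi) :* (uj :* vk :- uk :* vj) := :0) refl a b (u i) (u j) (u k) (v i) (v j) (v k))

    -- Cramer's rule on the coordinates i and j gives the coefficients a and b of w.
    wedge≡0⇒inSpan : ∀ w {i j} → coords L i j ≢ 0# → (∀ k → wedge (coords L) w i j k ≡ 0#) → InSpan w L
    wedge≡0⇒inSpan w {i} {j} p≢0 vanish = a , b , λ k → sym (begin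
      a * u k + b * v k                              ≡⟨ sym (trans (cong (a * u k + b * v k +_) (zeroʳ z)) (+-identityʳ _)) ⟩
      a * u k + b * v k + z * 0#                     ≡⟨ cong (λ t → a * u k + b * v k + z * t) (sym (vanish k)) ⟩
      a * u k + b * v k + z * wedge (coords L) w i j k   ≡⟨ cramer (w i) (w j) (w k) (u i) (u j) (u k) (v i) (v j) (v k) z ⟩
      (coords L i j * z) * w k                       ≡⟨ cong (_* w k) (⁻¹-inverse _ p≢0) ⟩
      1# * w k                                       ≡⟨ *-identityˡ _ ⟩
      w k                                            ∎)
      where
      open ≡-Reasoning
      z a b : Carrier
      z = coords L i j ⁻¹
      a = (w i * v j - w j * v i) * z
      b = (u i * w j - u j * w i) * z
      cramer : ∀ wi wj wk ui uj uk vi vj vk z →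
        ((wi * vj - wj * vi) * z) * uk + ((ui * wj - uj * wi) * z) * vk
          + z * (wk * (ui * vj - uj * vi) - wj * (ui * vk - uk * vi) + wi * (uj * vk - uk * vj))
        ≡ ((ui * vj - uj * vi) * z) * wk
      cramer = solve 10 (λ wi wj wk ui uj uk vi vj vk z →
        ((wi :* vj :- wj :* vi) :* z) :* uk :+ ((ui :* wj :- uj :* wi) :* z) :* vk
          :+ z :* (wk :* (ui :* vj :- uj :* vi) :- wj :* (ui :* vk :- uk :* vi) :+ wi :* (uj :* vk :- uk :* vj))
        := ((ui :* vj :- uj :* vi) :* z) :* wk) refl

    -- If all coordinates vanish, v_k u − u_k v = 0 for every k, so independence forces u = 0.
    ¬coords≡0 : ¬ (∀ i j → coords L i j ≡ 0#)
    ¬coords≡0 coords≡0 with ¬∀⟶∃¬ 4 (λ k → u k ≡ 0#) (λ k → u k ≟ 0#) u≢0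
      where
      u≢0 : ¬ (∀ k → u k ≡ 0#)
      u≢0 u≡0 = 0≢1 (sym (proj₁ (Line.independent L 1# 0# λ i →
        trans (cong₂ _+_ (*-identityˡ (u i)) (zeroˡ (v i))) (trans (+-identityʳ (u i)) (u≡0 i)))))
    ... | k , uk≢0 = uk≢0 (-x≡0⇒x≡0 (proj₂ (Line.independent L (v k) (- u k) λ i →
      trans (solve 4 (λ uk ui vk vi → vk :* ui :+ (:- uk) :* vi := :- (uk :* vi :- ui :* vk)) refl (u k) (u i) (v k) (v i))
            (trans (cong -_ (coords≡0 k i)) -0#≈0#))))

    someCoord≢0 : ∃[ i ] ∃[ j ] coords L i j ≢ 0#
    someCoord≢0 =
      let i , row≢0 = ¬∀⟶∃¬ 4 (λ i → ∀ j → coords L i j ≡ 0#) (λ i → all? λ j → coords L i j ≟ 0#) ¬coords≡0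
          j , p≢0   = ¬∀⟶∃¬ 4 (λ j → coords L i j ≡ 0#) (λ j → coords L i j ≟ 0#) row≢0
      in i , j , p≢0

    inSpan? : ∀ w → Dec (InSpan w L)
    inSpan? w =
      let i , j , p≢0 = someCoord≢0
      in map′ (wedge≡0⇒inSpan w p≢0) (λ w∈L → inSpan⇒wedge≡0 w∈L i j) (all? λ k → wedge (coords L) w i j k ≟ 0#)

    u∈L : InSpan u L
    u∈L = 1# , 0# , λ i → sym (trans (cong₂ _+_ (*-identityˡ (u i)) (zeroˡ (v i))) (+-identityʳ (u i)))

    v∈L : InSpan v L
    v∈L = 0# , 1# , λ i → sym (trans (cong₂ _+_ (zeroˡ (u i)) (*-identityˡ (v i))) (+-identityˡ (v i)))

  span⊆ : ∀ {L M w} → InSpan (Line.u M) L → InSpan (Line.v M) L → InSpan w M → InSpan w L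
  span⊆ {L} (a₁ , b₁ , u≡) (a₂ , b₂ , v≡) (c , d , w≡) = c * a₁ + d * a₂ , c * b₁ + d * b₂ , λ i →
    trans (w≡ i) (trans (cong₂ (λ x y → c * x + d * y) (u≡ i) (v≡ i))
      (solve 8 (λ c d a₁ b₁ a₂ b₂ x y → c :* (a₁ :* x :+ b₁ :* y) :+ d :* (a₂ :* x :+ b₂ :* y)
                  := (c :* a₁ :+ d :* a₂) :* x :+ (c :* b₁ :+ d :* b₂) :* y) refl
             c d a₁ b₁ a₂ b₂ (Line.u L i) (Line.v L i)))

  ≈L-intro : ∀ {L M} → InSpan (Line.u M) L → InSpan (Line.v M) L → InSpan (Line.u L) M → InSpan (Line.v L) M → L ≈L M
  ≈L-intro {L} {M} uM∈L vM∈L uL∈M vL∈M w = mk⇔ (span⊆ {M} {L} uL∈M vL∈M) (span⊆ {L} {M} uM∈L vM∈L)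

  ≈L-refl : ∀ {L} → L ≈L L
  ≈L-refl w = ⇔.refl

  ≈L-sym : ∀ {L M} → L ≈L M → M ≈L L
  ≈L-sym L≈M w = ⇔.sym (L≈M w)

  ≈L-trans : ∀ {L M N} → L ≈L M → M ≈L N → L ≈L N
  ≈L-trans L≈M M≈N w = ⇔.trans (L≈M w) (M≈N w)

  _≈L?_ : ∀ L M → Dec (L ≈L M)
  L ≈L? M = map′ (λ (uM∈L , vM∈L , uL∈M , vL∈M) → ≈L-intro {L} {M} uM∈L vM∈L uL∈M vL∈M)
                 (λ L≈M → from (L≈M _) (u∈L M) , from (L≈M _) (v∈L M) , to (L≈M _) (u∈L L) , to (L≈M _) (v∈L L))
                 (inSpan? L (Line.u M) ×-dec inSpan? L (Line.v M) ×-dec inSpan? M (Line.u L) ×-dec inSpan? M (Line.v L))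

  wedge-congˡ : ∀ {p q} w → (∀ i j → p i j ≡ q i j) → ∀ i j k → wedge p w i j k ≡ wedge q w i j k
  wedge-congˡ w p≡q i j k = cong₂ _+_ (cong₂ _-_ (cong (w k *_) (p≡q i j)) (cong (w j *_) (p≡q i k))) (cong (w i *_) (p≡q j k))

  *-wedge : ∀ c p w i j k → c * wedge p w i j k ≡ wedge (λ i j → c * p i j) w i j k
  *-wedge c p w i j k = solve 7 (λ c wi wj wk pij pik pjk →
    c :* (wk :* pij :- wj :* pik :+ wi :* pjk) := wk :* (c :* pij) :- wj :* (c :* pik) :+ wi :* (c :* pjk)) refl
    c (w i) (w j) (w k) (p i j) (p i k) (p j k)

  proportional⇒⊆ : ∀ {α β L M} → β ≢ 0# → (∀ i j → α * coords M i j ≡ β * coords L i j) → ∀ w → InSpan w M → InSpan w L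
  proportional⇒⊆ {α} {β} {L} {M} β≢0 prop w w∈M = wedge≡0⇒inSpan L w p≢0 λ k → x*y≡0⇒y≡0 β≢0 (begin
    β * wedge (coords L) w i j k                   ≡⟨ *-wedge β (coords L) w i j k ⟩
    wedge (λ i j → β * coords L i j) w i j k      ≡⟨ wedge-congˡ w (λ i j → sym (prop i j)) i j k ⟩
    wedge (λ i j → α * coords M i j) w i j k      ≡⟨ sym (*-wedge α (coords M) w i j k) ⟩
    α * wedge (coords M) w i j k                   ≡⟨ cong (α *_) (inSpan⇒wedge≡0 M w∈M i j k) ⟩
    α * 0#                                         ≡⟨ zeroʳ α ⟩
    0#                                             ∎)
    where
    open ≡-Reasoning
    i j : Fin 4
    i = proj₁ (someCoord≢0 L)
    j = proj₁ (proj₂ (someCoord≢0 L))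
    p≢0 : coords L i j ≢ 0#
    p≢0 = proj₂ (proj₂ (someCoord≢0 L))

  proportional⇒≈L : ∀ {α β L M} → α ≢ 0# → β ≢ 0# →
    α * coords M 0F 1F ≡ β * coords L 0F 1F → α * coords M 0F 2F ≡ β * coords L 0F 2F → α * coords M 0F 3F ≡ β * coords L 0F 3F →
    α * coords M 1F 2F ≡ β * coords L 1F 2F → α * coords M 1F 3F ≡ β * coords L 1F 3F → α * coords M 2F 3F ≡ β * coords L 2F 3F →
    L ≈L M
  proportional⇒≈L {α} {β} {L} {M} α≢0 β≢0 p01 p02 p03 p12 p13 p23 w =
    mk⇔ (proportional⇒⊆ {β} {α} {M} {L} α≢0 (λ i j → sym (prop i j)) w) (proportional⇒⊆ {α} {β} {L} {M} β≢0 prop w)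
    where
    prop : ∀ i j → α * coords M i j ≡ β * coords L i j
    prop = fromSixPairs (λ i j → α * coords M i j ≡ β * coords L i j)
      (λ i → trans (cong (α *_) (coords-diag M i)) (trans (zeroʳ α) (sym (trans (cong (β *_) (coords-diag L i)) (zeroʳ β)))))
      (λ {i} {j} e → begin
        α * coords M j i      ≡⟨ cong (α *_) (coords-antisym M i j) ⟩
        α * - coords M i j    ≡⟨ sym (-‿distribʳ-* α _) ⟩
        - (α * coords M i j)  ≡⟨ cong -_ e ⟩
        - (β * coords L i j)  ≡⟨ -‿distribʳ-* β _ ⟩
        β * - coords L i j    ≡⟨ cong (β *_) (sym (coords-antisym L i j)) ⟩
        β * coords L j i      ∎)
      p01 p02 p03 p12 p13 p23
      where open ≡-Reasoning

  Meets : Line → Line → Set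
  Meets L M = ∃[ a ] ∃[ b ] (¬ (a ≡ 0# × b ≡ 0#) × InSpan (lin a b (Line.u L) (Line.v L)) M)

  vec4-η : ∀ {x x′ : Vec4} → (∀ i → x i ≡ x′ i) → vec4 (x 0F) (x 1F) (x 2F) (x 3F) ≡ vec4 (x′ 0F) (x′ 1F) (x′ 2F) (x′ 3F)
  vec4-η x≡ = cong₂ (λ (a , b) (c , d) → vec4 a b c d) (cong₂ _,_ (x≡ 0F) (x≡ 1F)) (cong₂ _,_ (x≡ 2F) (x≡ 3F))

  klein-cong : ∀ {x x′ y y′ : Vec4} q → (∀ i → x i ≡ x′ i) → (∀ i → y i ≡ y′ i) → klein (plücker x y) q ≡ klein (plücker x′ y′) q
  klein-cong q x≡ y≡ = cong₂ (λ x y → klein (plücker x y) q) (vec4-η x≡) (vec4-η y≡)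

  -- Klein's form is the determinant det(u, v, m, n), which is multilinear and alternating.
  meets⇒klein≡0 : ∀ {L M} → Meets L M → klein (coords L) (coords M) ≡ 0#
  meets⇒klein≡0 {L} {M} (a , b , ¬a≡0×b≡0 , c , d , w≡) = case (a ≟ 0#)
    where
    u v m n : Vec4
    u = Line.u L
    v = Line.v L
    m = Line.u M
    n = Line.v M
    K : Carrier
    K = klein (coords L) (coords M)
    replace-u : a * K ≡ klein (plücker (lin c d m n) v) (coords M)
    replace-u = trans
      (solve 18 (λ a b u₀ u₁ u₂ u₃ v₀ v₁ v₂ v₃ m₀ m₁ m₂ m₃ n₀ n₁ n₂ n₃ → let
          u = vec4 u₀ u₁ u₂ u₃ ; v = vec4 v₀ v₁ v₂ v₃ ; m = vec4 m₀ m₁ m₂ m₃ ; n = vec4 n₀ n₁ n₂ n₃ in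
          a :* Poly.klein (Poly.plücker u v) (Poly.plücker m n) := Poly.klein (Poly.plücker (Poly.lin a b u v) v) (Poly.plücker m n)) refl
        a b (u 0F) (u 1F) (u 2F) (u 3F) (v 0F) (v 1F) (v 2F) (v 3F) (m 0F) (m 1F) (m 2F) (m 3F) (n 0F) (n 1F) (n 2F) (n 3F))
      (klein-cong {lin a b u v} {lin c d m n} {v} {v} (coords M) w≡ (λ _ → refl))
    replace-v : b * K ≡ klein (plücker u (lin c d m n)) (coords M)
    replace-v = trans
      (solve 18 (λ a b u₀ u₁ u₂ u₃ v₀ v₁ v₂ v₃ m₀ m₁ m₂ m₃ n₀ n₁ n₂ n₃ → let
          u = vec4 u₀ u₁ u₂ u₃ ; v = vec4 v₀ v₁ v₂ v₃ ; m = vec4 m₀ m₁ m₂ m₃ ; n = vec4 n₀ n₁ n₂ n₃ in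
          b :* Poly.klein (Poly.plücker u v) (Poly.plücker m n) := Poly.klein (Poly.plücker u (Poly.lin a b u v)) (Poly.plücker m n)) refl
        a b (u 0F) (u 1F) (u 2F) (u 3F) (v 0F) (v 1F) (v 2F) (v 3F) (m 0F) (m 1F) (m 2F) (m 3F) (n 0F) (n 1F) (n 2F) (n 3F))
      (klein-cong {u} {u} {lin a b u v} {lin c d m n} (coords M) (λ _ → refl) w≡)
    M-dependentˡ : klein (plücker (lin c d m n) v) (coords M) ≡ 0#
    M-dependentˡ = solve 14 (λ c d v₀ v₁ v₂ v₃ m₀ m₁ m₂ m₃ n₀ n₁ n₂ n₃ → let
          v = vec4 v₀ v₁ v₂ v₃ ; m = vec4 m₀ m₁ m₂ m₃ ; n = vec4 n₀ n₁ n₂ n₃ in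
          Poly.klein (Poly.plücker (Poly.lin c d m n) v) (Poly.plücker m n) := :0) refl
        c d (v 0F) (v 1F) (v 2F) (v 3F) (m 0F) (m 1F) (m 2F) (m 3F) (n 0F) (n 1F) (n 2F) (n 3F)
    M-dependentʳ : klein (plücker u (lin c d m n)) (coords M) ≡ 0#
    M-dependentʳ = solve 14 (λ c d u₀ u₁ u₂ u₃ m₀ m₁ m₂ m₃ n₀ n₁ n₂ n₃ → let
          u = vec4 u₀ u₁ u₂ u₃ ; m = vec4 m₀ m₁ m₂ m₃ ; n = vec4 n₀ n₁ n₂ n₃ in
          Poly.klein (Poly.plücker u (Poly.lin c d m n)) (Poly.plücker m n) := :0) refl
        c d (u 0F) (u 1F) (u 2F) (u 3F) (m 0F) (m 1F) (m 2F) (m 3F) (n 0F) (n 1F) (n 2F) (n 3F)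
    case : Dec (a ≡ 0#) → K ≡ 0#
    case (no a≢0) = x*y≡0⇒y≡0 a≢0 (trans replace-u M-dependentˡ)
    case (yes a≡0) = x*y≡0⇒y≡0 (λ b≡0 → ¬a≡0×b≡0 (a≡0 , b≡0)) (trans replace-v M-dependentʳ)

  Cover : Fin 4 → Fin 4 → Fin 4 → Fin 4 → Set
  Cover i j k₁ k₂ = ∀ k → k ≡ i ⊎ k ≡ j ⊎ k ≡ k₁ ⊎ k ≡ k₂

  cover? : ∀ i j k₁ k₂ → Dec (Cover i j k₁ k₂)
  cover? i j k₁ k₂ = all? λ k → k Fin.≟ i ⊎-dec k Fin.≟ j ⊎-dec k Fin.≟ k₁ ⊎-dec k Fin.≟ k₂

  wedge-lin : ∀ p a b x y i j k → wedge p (lin a b x y) i j k ≡ a * wedge p x i j k + b * wedge p y i j k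
  wedge-lin p a b x y i j k = solve 11 (λ a b xi xj xk yi yj yk pij pik pjk →
    (a :* xk :+ b :* yk) :* pij :- (a :* xj :+ b :* yj) :* pik :+ (a :* xi :+ b :* yi) :* pjk
      := a :* (xk :* pij :- xj :* pik :+ xi :* pjk) :+ b :* (yk :* pij :- yj :* pik :+ yi :* pjk)) refl
    a b (x i) (x j) (x k) (y i) (y j) (y k) (p i j) (p i k) (p j k)

  wedge-at-i : ∀ M x i j → wedge (coords M) x i j i ≡ 0#
  wedge-at-i M x i j = solve 6 (λ xi xj mi mj ni nj →
    xi :* (mi :* nj :- mj :* ni) :- xj :* (mi :* ni :- mi :* ni) :+ xi :* (mj :* ni :- mi :* nj) := :0) refl
    (x i) (x j) (Line.u M i) (Line.u M j) (Line.v M i) (Line.v M j)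

  wedge-at-j : ∀ M x i j → wedge (coords M) x i j j ≡ 0#
  wedge-at-j M x i j = solve 6 (λ xi xj mi mj ni nj →
    xj :* (mi :* nj :- mj :* ni) :- xj :* (mi :* nj :- mj :* ni) :+ xi :* (mj :* nj :- mj :* nj) := :0) refl
    (x i) (x j) (Line.u M i) (Line.u M j) (Line.v M i) (Line.v M j)

  module _ (L M : Line) {i j : Fin 4} where
    private
      c d : Fin 4 → Carrier
      c = wedge (coords M) (Line.u L) i j
      d = wedge (coords M) (Line.v L) i j

      meets-if-dependent : ∀ {k₁ k₂} → coords M i j ≢ 0# → Cover i j k₁ k₂ → ∀ a b → ¬ (a ≡ 0# × b ≡ 0#) →
        a * c k₁ + b * d k₁ ≡ 0# → a * c k₂ + b * d k₂ ≡ 0# → Meets L M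
      meets-if-dependent {k₁} {k₂} p≢0 cover a b ¬a≡0×b≡0 at-k₁ at-k₂ =
        a , b , ¬a≡0×b≡0 , wedge≡0⇒inSpan M _ p≢0 λ k → trans (wedge-lin (coords M) a b _ _ i j k) (vanish k (cover k))
        where
        vanish : ∀ k → k ≡ i ⊎ k ≡ j ⊎ k ≡ k₁ ⊎ k ≡ k₂ → a * c k + b * d k ≡ 0#
        vanish k (inj₁ refl) = *+-vanish (wedge-at-i M _ i j) (*-vanish (wedge-at-i M _ i j))
        vanish k (inj₂ (inj₁ refl)) = *+-vanish (wedge-at-j M _ i j) (*-vanish (wedge-at-j M _ i j))
        vanish k (inj₂ (inj₂ (inj₁ refl))) = at-k₁
        vanish k (inj₂ (inj₂ (inj₂ refl))) = at-k₂

    -- If the columns (c k, d k) at k₁ and k₂ are dependent, (a, b) can be read off a nonzero column.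
    klein≡0⇒meets-in : ∀ {k₁ k₂} → coords M i j ≢ 0# → Cover i j k₁ k₂ →
      c k₁ * d k₂ - d k₁ * c k₂ ≡ coords M i j * klein (coords L) (coords M) → klein (coords L) (coords M) ≡ 0# → Meets L M
    klein≡0⇒meets-in {k₁} {k₂} p≢0 cover minor≡ klein≡0 = case (c k₁ ≟ 0#) (d k₁ ≟ 0#) (c k₂ ≟ 0#) (d k₂ ≟ 0#)
      where
      minor≡0 : c k₁ * d k₂ - d k₁ * c k₂ ≡ 0#
      minor≡0 = trans minor≡ (trans (cong (coords M i j *_) klein≡0) (zeroʳ _))
      cancel : ∀ x y → y * x + - x * y ≡ 0#
      cancel = solve 2 (λ x y → y :* x :+ (:- x) :* y := :0) refl
      column₁ : ¬ (c k₁ ≡ 0# × d k₁ ≡ 0#) → Meets L M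
      column₁ ≢0 = meets-if-dependent p≢0 cover (d k₁) (- c k₁) (λ (d≡0 , -c≡0) → ≢0 (-x≡0⇒x≡0 -c≡0 , d≡0))
        (cancel (c k₁) (d k₁))
        (trans (solve 4 (λ c₁ d₁ c₂ d₂ → d₁ :* c₂ :+ (:- c₁) :* d₂ := :- (c₁ :* d₂ :- d₁ :* c₂)) refl (c k₁) (d k₁) (c k₂) (d k₂))
               (trans (cong -_ minor≡0) -0#≈0#))
      column₂ : c k₁ ≡ 0# → d k₁ ≡ 0# → ¬ (c k₂ ≡ 0# × d k₂ ≡ 0#) → Meets L M
      column₂ c≡0 d≡0 ≢0 = meets-if-dependent p≢0 cover (d k₂) (- c k₂) (λ (d≡0 , -c≡0) → ≢0 (-x≡0⇒x≡0 -c≡0 , d≡0))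
        (*+-vanish c≡0 (*-vanish d≡0))
        (cancel (c k₂) (d k₂))
      c-vanishes : c k₁ ≡ 0# → c k₂ ≡ 0# → Meets L M
      c-vanishes c₁≡0 c₂≡0 = meets-if-dependent p≢0 cover 1# 0# (λ (1≡0 , _) → 1≢0 1≡0)
        (*+-vanish c₁≡0 (zeroˡ _)) (*+-vanish c₂≡0 (zeroˡ _))
      case : Dec (c k₁ ≡ 0#) → Dec (d k₁ ≡ 0#) → Dec (c k₂ ≡ 0#) → Dec (d k₂ ≡ 0#) → Meets L M
      case (no c₁≢0) _ _ _ = column₁ (c₁≢0 ∘ proj₁)
      case (yes _) (no d₁≢0) _ _ = column₁ (d₁≢0 ∘ proj₂)
      case (yes c₁≡0) (yes d₁≡0) (no c₂≢0) _ = column₂ c₁≡0 d₁≡0 (c₂≢0 ∘ proj₁)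
      case (yes c₁≡0) (yes d₁≡0) (yes _) (no d₂≢0) = column₂ c₁≡0 d₁≡0 (d₂≢0 ∘ proj₂)
      case (yes c₁≡0) (yes _) (yes c₂≡0) (yes _) = c-vanishes c₁≡0 c₂≡0

  private
    minorIdentity : (i j k₁ k₂ : Fin 4) → N-ary 16 (Polynomial 16) (Polynomial 16 × Polynomial 16)
    minorIdentity i j k₁ k₂ u₀ u₁ u₂ u₃ v₀ v₁ v₂ v₃ m₀ m₁ m₂ m₃ n₀ n₁ n₂ n₃ =
      c k₁ :* d k₂ :- d k₁ :* c k₂ := Poly.plücker m n i j :* Poly.klein (Poly.plücker u v) (Poly.plücker m n)
      where
      u v m n : Fin 4 → Polynomial 16
      u = vec4 u₀ u₁ u₂ u₃
      v = vec4 v₀ v₁ v₂ v₃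
      m = vec4 m₀ m₁ m₂ m₃
      n = vec4 n₀ n₁ n₂ n₃
      c d : Fin 4 → Polynomial 16
      c = Poly.wedge (Poly.plücker m n) u i j
      d = Poly.wedge (Poly.plücker m n) v i j

  -- In the chart where the coordinate (i, j) of M is nonzero, the 2×2 minors of the columns
  -- (c k, d k) are multiples of Klein's form.
  klein≡0⇒meets : ∀ L M → klein (coords L) (coords M) ≡ 0# → Meets L M
  klein≡0⇒meets L M klein≡0 = let i , j , p≢0 = someCoord≢0 M in chart i j p≢0
    where
    u v m n : Vec4
    u = Line.u L
    v = Line.v L
    m = Line.u M
    n = Line.v M
    cover : ∀ i j k₁ k₂ → {True (cover? i j k₁ k₂)} → Cover i j k₁ k₂
    cover i j k₁ k₂ {c} = toWitness c
    chart : ∀ i j → coords M i j ≢ 0# → Meets L M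
    chart 0F 1F p≢0 = klein≡0⇒meets-in L M p≢0 (cover 0F 1F 2F 3F) (solve 16 (minorIdentity 0F 1F 2F 3F) refl
      (u 0F) (u 1F) (u 2F) (u 3F) (v 0F) (v 1F) (v 2F) (v 3F) (m 0F) (m 1F) (m 2F) (m 3F) (n 0F) (n 1F) (n 2F) (n 3F)) klein≡0
    chart 0F 2F p≢0 = klein≡0⇒meets-in L M p≢0 (cover 0F 2F 3F 1F) (solve 16 (minorIdentity 0F 2F 3F 1F) refl
      (u 0F) (u 1F) (u 2F) (u 3F) (v 0F) (v 1F) (v 2F) (v 3F) (m 0F) (m 1F) (m 2F) (m 3F) (n 0F) (n 1F) (n 2F) (n 3F)) klein≡0
    chart 0F 3F p≢0 = klein≡0⇒meets-in L M p≢0 (cover 0F 3F 1F 2F) (solve 16 (minorIdentity 0F 3F 1F 2F) refl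
      (u 0F) (u 1F) (u 2F) (u 3F) (v 0F) (v 1F) (v 2F) (v 3F) (m 0F) (m 1F) (m 2F) (m 3F) (n 0F) (n 1F) (n 2F) (n 3F)) klein≡0
    chart 1F 2F p≢0 = klein≡0⇒meets-in L M p≢0 (cover 1F 2F 0F 3F) (solve 16 (minorIdentity 1F 2F 0F 3F) refl
      (u 0F) (u 1F) (u 2F) (u 3F) (v 0F) (v 1F) (v 2F) (v 3F) (m 0F) (m 1F) (m 2F) (m 3F) (n 0F) (n 1F) (n 2F) (n 3F)) klein≡0
    chart 1F 3F p≢0 = klein≡0⇒meets-in L M p≢0 (cover 1F 3F 2F 0F) (solve 16 (minorIdentity 1F 3F 2F 0F) refl
      (u 0F) (u 1F) (u 2F) (u 3F) (v 0F) (v 1F) (v 2F) (v 3F) (m 0F) (m 1F) (m 2F) (m 3F) (n 0F) (n 1F) (n 2F) (n 3F)) klein≡0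
    chart 2F 3F p≢0 = klein≡0⇒meets-in L M p≢0 (cover 2F 3F 0F 1F) (solve 16 (minorIdentity 2F 3F 0F 1F) refl
      (u 0F) (u 1F) (u 2F) (u 3F) (v 0F) (v 1F) (v 2F) (v 3F) (m 0F) (m 1F) (m 2F) (m 3F) (n 0F) (n 1F) (n 2F) (n 3F)) klein≡0
    chart 1F 0F p≢0 = chart 0F 1F (p≢0 ∘ coords≡0-flip M)
    chart 2F 0F p≢0 = chart 0F 2F (p≢0 ∘ coords≡0-flip M)
    chart 3F 0F p≢0 = chart 0F 3F (p≢0 ∘ coords≡0-flip M)
    chart 2F 1F p≢0 = chart 1F 2F (p≢0 ∘ coords≡0-flip M)
    chart 3F 1F p≢0 = chart 1F 3F (p≢0 ∘ coords≡0-flip M)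
    chart 3F 2F p≢0 = chart 2F 3F (p≢0 ∘ coords≡0-flip M)
    chart i@0F 0F p≢0 = ⊥-elim (p≢0 (coords-diag M i))
    chart i@1F 1F p≢0 = ⊥-elim (p≢0 (coords-diag M i))
    chart i@2F 2F p≢0 = ⊥-elim (p≢0 (coords-diag M i))
    chart i@3F 3F p≢0 = ⊥-elim (p≢0 (coords-diag M i))

  meets? : ∀ L M → Dec (Meets L M)
  meets? L M = map′ (klein≡0⇒meets L M) (meets⇒klein≡0 {L} {M}) (klein (coords L) (coords M) ≟ 0#)

module IncidenceGraph (F : FiniteField) where
  open FieldTheory F
  open Lines F

  lin-nonzero : ∀ L a b → ¬ (a ≡ 0# × b ≡ 0#) → ∃[ i ] lin a b (Line.u L) (Line.v L) i ≢ 0#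
  lin-nonzero L a b ¬a≡0×b≡0 = ¬∀⟶∃¬ 4 _ (λ i → lin a b (Line.u L) (Line.v L) i ≟ 0#)
    (λ lin≡0 → ¬a≡0×b≡0 (Line.independent L a b lin≡0))

  walk₂⇔meets : ∀ {L M} → Walk 2 (inj₂ L) (inj₂ M) ⇔ Meets L M
  walk₂⇔meets {L} {M} = mk⇔
    (λ { (inj₁ P , (a , b , P≡) , inj₂ N , P∈N , N≈M) →
         a , b , ¬a≡0×b≡0 P P≡ , inSpan-resp {N = M} P≡ (to (N≈M (Point.vec P)) P∈N) })
    (λ (a , b , ¬a≡0×b≡0 , w∈M) →
         inj₁ (point (lin a b (Line.u L) (Line.v L)) (lin-nonzero L a b ¬a≡0×b≡0)) , (a , b , λ _ → refl) , inj₂ M , w∈M , ≈L-refl {M})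
    where
    inSpan-resp : ∀ {w w′ N} → (∀ i → w i ≡ w′ i) → InSpan w N → InSpan w′ N
    inSpan-resp w≡ (a , b , w≡′) = a , b , λ i → trans (sym (w≡ i)) (w≡′ i)
    ¬a≡0×b≡0 : ∀ P {a b} → (∀ i → Point.vec P i ≡ lin a b (Line.u L) (Line.v L) i) → ¬ (a ≡ 0# × b ≡ 0#)
    ¬a≡0×b≡0 (point w (i , wi≢0)) P≡ (refl , refl) =
      wi≢0 (trans (P≡ i) (trans (cong₂ _+_ (zeroˡ _) (zeroˡ _)) (+-identityˡ 0#)))

  walk₁⇔incident : ∀ {L P} → Walk 1 (inj₂ L) (inj₁ P) ⇔ P I L
  walk₁⇔incident {L} {P} = mk⇔
    (λ { (inj₁ Q , (a , b , Q≡) , c , c≢0 , Q≡cP) → c ⁻¹ * a , c ⁻¹ * b , λ i → begin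
           Point.vec P i                                  ≡⟨ sym (*-identityˡ _) ⟩
           1# * Point.vec P i                             ≡⟨ cong (_* Point.vec P i) (sym (⁻¹-inverseˡ c≢0)) ⟩
           c ⁻¹ * c * Point.vec P i                       ≡⟨ *-assoc _ _ _ ⟩
           c ⁻¹ * (c * Point.vec P i)                     ≡⟨ cong (c ⁻¹ *_) (trans (sym (Q≡cP i)) (Q≡ i)) ⟩
           c ⁻¹ * (a * Line.u L i + b * Line.v L i)       ≡⟨ distribˡ _ _ _ ⟩
           c ⁻¹ * (a * Line.u L i) + c ⁻¹ * (b * Line.v L i) ≡⟨ cong₂ _+_ (sym (*-assoc _ _ _)) (sym (*-assoc _ _ _)) ⟩
           c ⁻¹ * a * Line.u L i + c ⁻¹ * b * Line.v L i  ∎ })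
    (λ P∈L → inj₁ P , P∈L , 1# , 1≢0 , λ i → sym (*-identityˡ _))
    where open ≡-Reasoning

  dist-≈L : ∀ {L M} → L ≈L M → Dist (inj₂ L) (inj₂ M) 0
  dist-≈L L≈M = L≈M , λ _ ()

  dist-incident : ∀ {L P} → P I L → Dist (inj₂ L) (inj₁ P) 1
  dist-incident P∈L = from walk₁⇔incident P∈L , λ { zero _ () ; (suc _) (ℕ.s≤s ()) _ }

  dist-meets : ∀ {L M} → ¬ L ≈L M → Meets L M → Dist (inj₂ L) (inj₂ M) 2
  dist-meets {L} {M} L≉M L∩M = from walk₂⇔meets L∩M , shorter
    where
    shorter : ∀ k → k ℕ.< 2 → ¬ Walk k (inj₂ L) (inj₂ M)
    shorter zero _ L≈M = L≉M L≈M
    shorter (suc zero) _ (inj₁ _ , _ , ())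
    shorter (suc zero) _ (inj₂ _ , () , _)
    shorter (suc (suc _)) (ℕ.s≤s (ℕ.s≤s ())) _

  -- A sufficient condition for x to be at different distances from ℓ and ℓ′: distances between
  -- lines are 0, 2 or at least 4, and distances from a line to a point are 1 or at least 3.
  Separates : Line → Line → Vertex → Set
  Separates ℓ ℓ′ (inj₁ P) = (P I ℓ × ¬ P I ℓ′) ⊎ (P I ℓ′ × ¬ P I ℓ)
  Separates ℓ ℓ′ (inj₂ m) =
    (ℓ ≈L m × ¬ ℓ′ ≈L m) ⊎ (ℓ′ ≈L m × ¬ ℓ ≈L m) ⊎
    (¬ ℓ ≈L m × ¬ ℓ′ ≈L m × ((Meets ℓ m × ¬ Meets ℓ′ m) ⊎ (Meets ℓ′ m × ¬ Meets ℓ m)))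

  separates? : ∀ ℓ ℓ′ x → Dec (Separates ℓ ℓ′ x)
  separates? ℓ ℓ′ (inj₁ P) =
    (inSpan? ℓ (Point.vec P) ×-dec ¬? (inSpan? ℓ′ (Point.vec P))) ⊎-dec (inSpan? ℓ′ (Point.vec P) ×-dec ¬? (inSpan? ℓ (Point.vec P)))
  separates? ℓ ℓ′ (inj₂ m) =
    (ℓ ≈L? m ×-dec ¬? (ℓ′ ≈L? m)) ⊎-dec (ℓ′ ≈L? m ×-dec ¬? (ℓ ≈L? m)) ⊎-dec
    (¬? (ℓ ≈L? m) ×-dec ¬? (ℓ′ ≈L? m) ×-dec ((meets? ℓ m ×-dec ¬? (meets? ℓ′ m)) ⊎-dec (meets? ℓ′ m ×-dec ¬? (meets? ℓ m))))

  separates⇒distinguishes : ∀ ℓ ℓ′ x → Separates ℓ ℓ′ x → Distinguishes x (inj₂ ℓ) (inj₂ ℓ′)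
  separates⇒distinguishes ℓ ℓ′ (inj₁ P) (inj₁ (P∈ℓ , P∉ℓ′)) = inj₁ (1 , dist-incident P∈ℓ , P∉ℓ′ ∘ to walk₁⇔incident ∘ proj₁)
  separates⇒distinguishes ℓ ℓ′ (inj₁ P) (inj₂ (P∈ℓ′ , P∉ℓ)) = inj₂ (1 , dist-incident P∈ℓ′ , P∉ℓ ∘ to walk₁⇔incident ∘ proj₁)
  separates⇒distinguishes ℓ ℓ′ (inj₂ m) (inj₁ (ℓ≈m , ℓ′≉m)) = inj₁ (0 , dist-≈L ℓ≈m , ℓ′≉m ∘ proj₁)
  separates⇒distinguishes ℓ ℓ′ (inj₂ m) (inj₂ (inj₁ (ℓ′≈m , ℓ≉m))) = inj₂ (0 , dist-≈L ℓ′≈m , ℓ≉m ∘ proj₁)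
  separates⇒distinguishes ℓ ℓ′ (inj₂ m) (inj₂ (inj₂ (ℓ≉m , ℓ′≉m , inj₁ (ℓ∩m , ¬ℓ′∩m)))) =
    inj₁ (2 , dist-meets ℓ≉m ℓ∩m , ¬ℓ′∩m ∘ to walk₂⇔meets ∘ proj₁)
  separates⇒distinguishes ℓ ℓ′ (inj₂ m) (inj₂ (inj₂ (ℓ≉m , ℓ′≉m , inj₂ (ℓ′∩m , ¬ℓ∩m)))) =
    inj₂ (2 , dist-meets ℓ′≉m ℓ′∩m , ¬ℓ∩m ∘ to walk₂⇔meets ∘ proj₁)

-- The configuration consists of the lines L₀ t = ⟨e₀, e₂ + t e₃⟩, L₁ t = ⟨e₁, e₂ + t e₃⟩,
-- L₂ t = ⟨t e₀ + e₁, e₂⟩ and Lʸ t = ⟨t e₀ + e₁ − e₃, y⟩ through e₀, e₁, e₂ and y = e₀ + e₂,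
-- together with the points e₀ + t e₂ of L₀ 0.
module ConfigurationVectors {a} {A : Set a} (𝟘 𝟙 : A) (⊖_ : Op₁ A) where
  e₀ e₁ e₂ y : Fin 4 → A
  e₀ = vec4 𝟙 𝟘 𝟘 𝟘
  e₁ = vec4 𝟘 𝟙 𝟘 𝟘
  e₂ = vec4 𝟘 𝟘 𝟙 𝟘
  y = vec4 𝟙 𝟘 𝟙 𝟘

  e₂+te₃ te₀+e₁ te₀+e₁-e₃ e₀+te₂ : A → Fin 4 → A
  e₂+te₃ t = vec4 𝟘 𝟘 𝟙 t
  te₀+e₁ t = vec4 t 𝟙 𝟘 𝟘
  te₀+e₁-e₃ t = vec4 t 𝟙 𝟘 (⊖ 𝟙)
  e₀+te₂ t = vec4 𝟙 𝟘 t 𝟘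

module Configuration (F : FiniteField) where
  open FieldTheory F
  open Lines F
  open ConfigurationVectors 0# 1# -_
  module V {n} = ConfigurationVectors {A = Polynomial n} :0 :1 :-_

  echelonLine : ∀ (u v : Vec4) i j → u i ≡ 1# → v i ≡ 0# → u j ≡ 0# → v j ≡ 1# → B u v ≡ 0# → Line
  echelonLine u v i j ui≡1 vi≡0 uj≡0 vj≡1 isotropic = line u v independent isotropic
    where
    independent : ∀ a b → (∀ k → a * u k + b * v k ≡ 0#) → a ≡ 0# × b ≡ 0#
    independent a b lin≡0 =
      trans (sym (trans (lin-0ʳ a b 1#) (*-identityʳ a))) (trans (cong₂ (λ x y → a * x + b * y) (sym ui≡1) (sym vi≡0)) (lin≡0 i)) ,
      trans (sym (trans (lin-0ˡ a b 1#) (*-identityʳ b))) (trans (cong₂ (λ x y → a * x + b * y) (sym uj≡0) (sym vj≡1)) (lin≡0 j))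

  L₀ L₁ L₂ Lʸ : Carrier → Line
  L₀ t = echelonLine e₀ (e₂+te₃ t) 0F 2F refl refl refl refl (solve 1 (λ t → :1 :* :0 :+ :- (:0 :* :0) :+ :0 :* t :+ :- (:0 :* :1) := :0) refl t)
  L₁ t = echelonLine e₁ (e₂+te₃ t) 1F 2F refl refl refl refl (solve 1 (λ t → :0 :* :0 :+ :- (:1 :* :0) :+ :0 :* t :+ :- (:0 :* :1) := :0) refl t)
  L₂ t = echelonLine (te₀+e₁ t) e₂ 1F 2F refl refl refl refl (solve 1 (λ t → t :* :0 :+ :- (:1 :* :0) :+ :0 :* :0 :+ :- (:0 :* :1) := :0) refl t)
  Lʸ t = echelonLine (te₀+e₁-e₃ t) y 1F 2F refl refl refl refl (solve 1 (λ t → t :* :0 :+ :- (:1 :* :1) :+ :0 :* :0 :+ :- (:- :1 :* :1) := :0) refl t)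

  onL₀ : Carrier → Point
  onL₀ t = point (e₀+te₂ t) (0F , 1≢0)

  p₀₁ p₀₂ p₀₃ p₁₂ p₁₃ p₂₃ : Line → Carrier
  p₀₁ ℓ = coords ℓ 0F 1F
  p₀₂ ℓ = coords ℓ 0F 2F
  p₀₃ ℓ = coords ℓ 0F 3F
  p₁₂ ℓ = coords ℓ 1F 2F
  p₁₃ ℓ = coords ℓ 1F 3F
  p₂₃ ℓ = coords ℓ 2F 3F

  private
    lineIdentity : (f : (Fin 4 → Polynomial 9) → (Fin 4 → Polynomial 9) → Polynomial 9 → Polynomial 9 × Polynomial 9) →
                   N-ary 9 (Polynomial 9) (Polynomial 9 × Polynomial 9)
    lineIdentity f u₀ u₁ u₂ u₃ v₀ v₁ v₂ v₃ t = f (vec4 u₀ u₁ u₂ u₃) (vec4 v₀ v₁ v₂ v₃) t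

  module _ (ℓ : Line) where
    private
      u₀ u₁ u₂ u₃ v₀ v₁ v₂ v₃ : Carrier
      u₀ = Line.u ℓ 0F
      u₁ = Line.u ℓ 1F
      u₂ = Line.u ℓ 2F
      u₃ = Line.u ℓ 3F
      v₀ = Line.v ℓ 0F
      v₁ = Line.v ℓ 1F
      v₂ = Line.v ℓ 2F
      v₃ = Line.v ℓ 3F

    p₀₁+p₂₃≡0 : p₀₁ ℓ + p₂₃ ℓ ≡ 0#
    p₀₁+p₂₃≡0 = trans (sym (+-assoc _ _ _)) (Line.isotropic ℓ)

    klein-relation : p₀₁ ℓ * p₂₃ ℓ - p₀₂ ℓ * p₁₃ ℓ + p₀₃ ℓ * p₁₂ ℓ ≡ 0#
    klein-relation = solve 9 (lineIdentity λ u v _ → let p = Poly.plücker u v in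
      p 0F 1F :* p 2F 3F :- p 0F 2F :* p 1F 3F :+ p 0F 3F :* p 1F 2F := :0) refl u₀ u₁ u₂ u₃ v₀ v₁ v₂ v₃ 0#

    klein-L₀ : ∀ t → klein (coords ℓ) (coords (L₀ t)) ≡ t * p₁₂ ℓ - p₁₃ ℓ
    klein-L₀ t = solve 9 (lineIdentity λ u v t → let p = Poly.plücker u v in
      Poly.klein p (Poly.plücker V.e₀ (V.e₂+te₃ t)) := t :* p 1F 2F :- p 1F 3F) refl u₀ u₁ u₂ u₃ v₀ v₁ v₂ v₃ t

    klein-L₁ : ∀ t → klein (coords ℓ) (coords (L₁ t)) ≡ p₀₃ ℓ - t * p₀₂ ℓ
    klein-L₁ t = solve 9 (lineIdentity λ u v t → let p = Poly.plücker u v in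
      Poly.klein p (Poly.plücker V.e₁ (V.e₂+te₃ t)) := p 0F 3F :- t :* p 0F 2F) refl u₀ u₁ u₂ u₃ v₀ v₁ v₂ v₃ t

    klein-L₂ : ∀ t → klein (coords ℓ) (coords (L₂ t)) ≡ p₀₃ ℓ - t * p₁₃ ℓ
    klein-L₂ t = solve 9 (lineIdentity λ u v t → let p = Poly.plücker u v in
      Poly.klein p (Poly.plücker (V.te₀+e₁ t) V.e₂) := p 0F 3F :- t :* p 1F 3F) refl u₀ u₁ u₂ u₃ v₀ v₁ v₂ v₃ t

    klein-Lʸ : ∀ t → klein (coords ℓ) (coords (Lʸ t)) ≡ p₀₁ ℓ - p₂₃ ℓ + p₀₃ ℓ + p₁₂ ℓ - t * p₁₃ ℓ
    klein-Lʸ t = solve 9 (lineIdentity λ u v t → let p = Poly.plücker u v in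
      Poly.klein p (Poly.plücker (V.te₀+e₁-e₃ t) V.y) := p 0F 1F :- p 2F 3F :+ p 0F 3F :+ p 1F 2F :- t :* p 1F 3F) refl u₀ u₁ u₂ u₃ v₀ v₁ v₂ v₃ t

    onL₀-incident : ∀ t → p₀₃ ℓ ≢ 0# → p₁₃ ℓ ≡ 0# → p₂₃ ℓ ≡ t * p₀₃ ℓ → onL₀ t I ℓ
    onL₀-incident t p₀₃≢0 p₁₃≡0 p₂₃≡tp₀₃ = wedge≡0⇒inSpan ℓ (e₀+te₂ t) p₀₃≢0 λ
      { 0F → wedge-at-i ℓ (e₀+te₂ t) 0F 3F
      ; 1F → trans (solve 9 (lineIdentity λ u v t → let p = Poly.plücker u v in
                     Poly.wedge p (V.e₀+te₂ t) 0F 3F 1F := :- p 1F 3F) refl u₀ u₁ u₂ u₃ v₀ v₁ v₂ v₃ t)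
                   (trans (cong -_ p₁₃≡0) -0#≈0#)
      ; 2F → trans (solve 9 (lineIdentity λ u v t → let p = Poly.plücker u v in
                     Poly.wedge p (V.e₀+te₂ t) 0F 3F 2F := t :* p 0F 3F :- p 2F 3F) refl u₀ u₁ u₂ u₃ v₀ v₁ v₂ v₃ t)
                   (x≡y⇒x-y≡0 (sym p₂₃≡tp₀₃))
      ; 3F → wedge-at-j ℓ (e₀+te₂ t) 0F 3F }

    incident-onL₀ : ∀ t → onL₀ t I ℓ → p₂₃ ℓ ≡ t * p₀₃ ℓ
    incident-onL₀ t onL₀∈ℓ = x-y≡0⇒x≡y (trans
      (solve 9 (lineIdentity λ u v t → let p = Poly.plücker u v in
        p 2F 3F :- t :* p 0F 3F := Poly.wedge p (V.e₀+te₂ t) 0F 2F 3F) refl u₀ u₁ u₂ u₃ v₀ v₁ v₂ v₃ t)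
      (inSpan⇒wedge≡0 ℓ onL₀∈ℓ 0F 2F 3F))

  meets⇔ : ∀ {ℓ M x y} → klein (coords ℓ) (coords M) ≡ x - y → Meets ℓ M ⇔ x ≡ y
  meets⇔ {ℓ} {M} klein≡ = mk⇔ (λ ℓ∩M → x-y≡0⇒x≡y (trans (sym klein≡) (meets⇒klein≡0 {ℓ} {M} ℓ∩M)))
                              (λ x≡y → klein≡0⇒meets ℓ M (trans klein≡ (x≡y⇒x-y≡0 x≡y)))

  Y : Line → Carrier
  Y ℓ = p₀₁ ℓ - p₂₃ ℓ + p₀₃ ℓ + p₁₂ ℓ

  meets-L₀ : ∀ ℓ t → Meets ℓ (L₀ t) ⇔ t * p₁₂ ℓ ≡ p₁₃ ℓ
  meets-L₀ ℓ t = meets⇔ {ℓ} {L₀ t} (klein-L₀ ℓ t)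

  meets-L₁ : ∀ ℓ t → Meets ℓ (L₁ t) ⇔ p₀₃ ℓ ≡ t * p₀₂ ℓ
  meets-L₁ ℓ t = meets⇔ {ℓ} {L₁ t} (klein-L₁ ℓ t)

  meets-L₂ : ∀ ℓ t → Meets ℓ (L₂ t) ⇔ p₀₃ ℓ ≡ t * p₁₃ ℓ
  meets-L₂ ℓ t = meets⇔ {ℓ} {L₂ t} (klein-L₂ ℓ t)

  meets-Lʸ : ∀ ℓ t → Meets ℓ (Lʸ t) ⇔ Y ℓ ≡ t * p₁₃ ℓ
  meets-Lʸ ℓ t = meets⇔ {ℓ} {Lʸ t} (klein-Lʸ ℓ t)

  record Outside (ℓ : Line) : Set where
    field
      ≉L₀ : ∀ t → ¬ ℓ ≈L L₀ t
      ≉L₂ : ∀ t → ¬ ℓ ≈L L₂ t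
      ≉Lʸ : ∀ t → ¬ ℓ ≈L Lʸ t

  -- Every vertex of S within distance 2 of ℓ is within distance 2 of ℓ′.
  record _⊑_ (ℓ ℓ′ : Line) : Set where
    field
      via-L₀ : ∀ t → Meets ℓ (L₀ t) → Meets ℓ′ (L₀ t)
      via-L₁ : ∀ t → t ≢ 0# → Meets ℓ (L₁ t) → Meets ℓ′ (L₁ t)
      via-L₂ : ∀ t → Meets ℓ (L₂ t) → Meets ℓ′ (L₂ t)
      via-Lʸ : ∀ t → Meets ℓ (Lʸ t) → Meets ℓ′ (Lʸ t)
      via-onL₀ : ∀ t → t ≢ 0# → t ≢ 1# → t ≢ 2# → onL₀ t I ℓ → onL₀ t I ℓ′

  scaled⇒≈L : ∀ {ℓ M} γ → γ ≢ 0# →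
    p₀₁ ℓ ≡ γ * p₀₁ M → p₀₂ ℓ ≡ γ * p₀₂ M → p₀₃ ℓ ≡ γ * p₀₃ M →
    p₁₂ ℓ ≡ γ * p₁₂ M → p₁₃ ℓ ≡ γ * p₁₃ M → p₂₃ ℓ ≡ γ * p₂₃ M →
    ℓ ≈L M
  scaled⇒≈L {ℓ} {M} γ γ≢0 e₀₁ e₀₂ e₀₃ e₁₂ e₁₃ e₂₃ =
    proportional⇒≈L {γ} {1#} {ℓ} {M} γ≢0 1≢0 (flip e₀₁) (flip e₀₂) (flip e₀₃) (flip e₁₂) (flip e₁₃) (flip e₂₃)
    where
    flip : ∀ {x c} → x ≡ γ * c → γ * c ≡ 1# * x
    flip e = trans (sym e) (sym (*-identityˡ _))

  private
    ≡γ*0 : ∀ {x c} γ → x ≡ 0# → c ≡ 0# → x ≡ γ * c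
    ≡γ*0 γ x≡0 c≡0 = trans x≡0 (sym (*-vanish c≡0))

    ≡γ*1 : ∀ {x c γ} → x ≡ γ → c ≡ 1# → x ≡ γ * c
    ≡γ*1 {γ = γ} x≡γ c≡1 = trans x≡γ (sym (trans (cong (γ *_) c≡1) (*-identityʳ γ)))

    ≡γ*-1 : ∀ {x c γ} → x ≡ - γ → c ≡ - 1# → x ≡ γ * c
    ≡γ*-1 {γ = γ} x≡-γ c≡-1 = trans x≡-γ (sym (trans (cong (γ *_) c≡-1) (trans (sym (-‿distribʳ-* γ 1#)) (cong -_ (*-identityʳ γ)))))

    ≡γ*quotient : ∀ {x c γ} → γ ≢ 0# → c ≡ x * γ ⁻¹ → x ≡ γ * c
    ≡γ*quotient {x} {γ = γ} γ≢0 c≡ = trans (quotient-root x γ≢0) (trans (*-comm _ _) (cong (γ *_) (sym c≡)))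

  -- ℓ is L₂ s, L₀ s or Lʸ s once its coordinates are proportional to (0, s, 0, 1, 0, 0), (0, 1, s, 0, 0, 0)
  -- or (-1, s, 1, 1, 0, 1).
  ≈L₂ : ∀ ℓ → p₀₁ ℓ ≡ 0# → p₀₃ ℓ ≡ 0# → p₁₃ ℓ ≡ 0# → p₂₃ ℓ ≡ 0# → p₁₂ ℓ ≢ 0# →
        ℓ ≈L L₂ (p₀₂ ℓ * p₁₂ ℓ ⁻¹)
  ≈L₂ ℓ p₀₁≡0 p₀₃≡0 p₁₃≡0 p₂₃≡0 p₁₂≢0 = scaled⇒≈L {ℓ} {L₂ s} γ p₁₂≢0
    (≡γ*0 γ p₀₁≡0 (solve 1 (λ s → Poly.plücker (V.te₀+e₁ s) V.e₂ 0F 1F := :0) refl s))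
    (≡γ*quotient p₁₂≢0 (solve 1 (λ s → Poly.plücker (V.te₀+e₁ s) V.e₂ 0F 2F := s) refl s))
    (≡γ*0 γ p₀₃≡0 (solve 1 (λ s → Poly.plücker (V.te₀+e₁ s) V.e₂ 0F 3F := :0) refl s))
    (≡γ*1 refl (solve 1 (λ s → Poly.plücker (V.te₀+e₁ s) V.e₂ 1F 2F := :1) refl s))
    (≡γ*0 γ p₁₃≡0 (solve 1 (λ s → Poly.plücker (V.te₀+e₁ s) V.e₂ 1F 3F := :0) refl s))
    (≡γ*0 γ p₂₃≡0 (solve 1 (λ s → Poly.plücker (V.te₀+e₁ s) V.e₂ 2F 3F := :0) refl s))
    where
    γ s : Carrier
    γ = p₁₂ ℓ
    s = p₀₂ ℓ * p₁₂ ℓ ⁻¹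

  ≈L₀ : ∀ ℓ → p₀₁ ℓ ≡ 0# → p₁₂ ℓ ≡ 0# → p₁₃ ℓ ≡ 0# → p₂₃ ℓ ≡ 0# → p₀₂ ℓ ≢ 0# →
        ℓ ≈L L₀ (p₀₃ ℓ * p₀₂ ℓ ⁻¹)
  ≈L₀ ℓ p₀₁≡0 p₁₂≡0 p₁₃≡0 p₂₃≡0 p₀₂≢0 = scaled⇒≈L {ℓ} {L₀ s} γ p₀₂≢0
    (≡γ*0 γ p₀₁≡0 (solve 1 (λ s → Poly.plücker V.e₀ (V.e₂+te₃ s) 0F 1F := :0) refl s))
    (≡γ*1 refl (solve 1 (λ s → Poly.plücker V.e₀ (V.e₂+te₃ s) 0F 2F := :1) refl s))
    (≡γ*quotient p₀₂≢0 (solve 1 (λ s → Poly.plücker V.e₀ (V.e₂+te₃ s) 0F 3F := s) refl s))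
    (≡γ*0 γ p₁₂≡0 (solve 1 (λ s → Poly.plücker V.e₀ (V.e₂+te₃ s) 1F 2F := :0) refl s))
    (≡γ*0 γ p₁₃≡0 (solve 1 (λ s → Poly.plücker V.e₀ (V.e₂+te₃ s) 1F 3F := :0) refl s))
    (≡γ*0 γ p₂₃≡0 (solve 1 (λ s → Poly.plücker V.e₀ (V.e₂+te₃ s) 2F 3F := :0) refl s))
    where
    γ s : Carrier
    γ = p₀₂ ℓ
    s = p₀₃ ℓ * p₀₂ ℓ ⁻¹

  ≈Lʸ : ∀ ℓ → p₀₁ ℓ ≡ - p₀₃ ℓ → p₁₂ ℓ ≡ p₀₃ ℓ → p₁₃ ℓ ≡ 0# → p₂₃ ℓ ≡ p₀₃ ℓ → p₀₃ ℓ ≢ 0# →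
        ℓ ≈L Lʸ (p₀₂ ℓ * p₀₃ ℓ ⁻¹)
  ≈Lʸ ℓ p₀₁≡-p₀₃ p₁₂≡p₀₃ p₁₃≡0 p₂₃≡p₀₃ p₀₃≢0 = scaled⇒≈L {ℓ} {Lʸ s} γ p₀₃≢0
    (≡γ*-1 p₀₁≡-p₀₃ (solve 1 (λ s → Poly.plücker (V.te₀+e₁-e₃ s) V.y 0F 1F := :- :1) refl s))
    (≡γ*quotient p₀₃≢0 (solve 1 (λ s → Poly.plücker (V.te₀+e₁-e₃ s) V.y 0F 2F := s) refl s))
    (≡γ*1 refl (solve 1 (λ s → Poly.plücker (V.te₀+e₁-e₃ s) V.y 0F 3F := :1) refl s))
    (≡γ*1 p₁₂≡p₀₃ (solve 1 (λ s → Poly.plücker (V.te₀+e₁-e₃ s) V.y 1F 2F := :1) refl s))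
    (≡γ*0 γ p₁₃≡0 (solve 1 (λ s → Poly.plücker (V.te₀+e₁-e₃ s) V.y 1F 3F := :0) refl s))
    (≡γ*1 p₂₃≡p₀₃ (solve 1 (λ s → Poly.plücker (V.te₀+e₁-e₃ s) V.y 2F 3F := :1) refl s))
    where
    γ s : Carrier
    γ = p₀₃ ℓ
    s = p₀₂ ℓ * p₀₃ ℓ ⁻¹

  data Shape (ℓ : Line) : Set where
    generic : p₁₃ ℓ ≢ 0# → Shape ℓ
    e₀e₃ : p₀₁ ℓ ≡ 0# → p₀₂ ℓ ≡ 0# → p₁₂ ℓ ≡ 0# → p₁₃ ℓ ≡ 0# → p₂₃ ℓ ≡ 0# → p₀₃ ℓ ≢ 0# → Shape ℓ
    through : ∀ t → t ≢ 0# → t ≢ 1# → p₀₃ ℓ ≢ 0# → p₁₃ ℓ ≡ 0# →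
              p₀₁ ℓ ≡ - (t * p₀₃ ℓ) → p₁₂ ℓ ≡ t * t * p₀₃ ℓ → p₂₃ ℓ ≡ t * p₀₃ ℓ → Shape ℓ

  module _ {ℓ : Line} (outside : Outside ℓ) (p₁₃≡0 : p₁₃ ℓ ≡ 0#) where
    private
      open Outside outside
      a₀₁ a₀₂ a₀₃ a₁₂ a₂₃ : Carrier
      a₀₁ = p₀₁ ℓ
      a₀₂ = p₀₂ ℓ
      a₀₃ = p₀₃ ℓ
      a₁₂ = p₁₂ ℓ
      a₂₃ = p₂₃ ℓ

    p₀₃≢0 : p₀₃ ℓ ≢ 0#
    p₀₃≢0 p₀₃≡0 = case (p₁₂ ℓ ≟ 0#) (p₀₂ ℓ ≟ 0#)
      where
      p₀₁≡0 : a₀₁ ≡ 0#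
      p₀₁≡0 = x*x≡0⇒x≡0 (trans
        (solve 6 (λ a₀₁ a₀₂ a₀₃ a₁₂ a₁₃ a₂₃ →
           a₀₁ :* a₀₁ := a₀₁ :* (a₀₁ :+ a₂₃)
                         :+ ((:- :1) :* (a₀₁ :* a₂₃ :- a₀₂ :* a₁₃ :+ a₀₃ :* a₁₂) :+ ((:- a₀₂) :* a₁₃ :+ a₁₂ :* a₀₃)))
           refl a₀₁ a₀₂ a₀₃ a₁₂ (p₁₃ ℓ) a₂₃)
        (*+-vanish (p₀₁+p₂₃≡0 ℓ) (*+-vanish (klein-relation ℓ) (*+-vanish p₁₃≡0 (*-vanish p₀₃≡0)))))
      p₂₃≡0 : a₂₃ ≡ 0#
      p₂₃≡0 = trans (sym (+-identityˡ a₂₃)) (trans (cong (_+ a₂₃) (sym p₀₁≡0)) (p₀₁+p₂₃≡0 ℓ))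
      case : Dec (a₁₂ ≡ 0#) → Dec (a₀₂ ≡ 0#) → ⊥
      case (no p₁₂≢0) _ = ≉L₂ _ (≈L₂ ℓ p₀₁≡0 p₀₃≡0 p₁₃≡0 p₂₃≡0 p₁₂≢0)
      case (yes p₁₂≡0) (no p₀₂≢0) = ≉L₀ _ (≈L₀ ℓ p₀₁≡0 p₁₂≡0 p₁₃≡0 p₂₃≡0 p₀₂≢0)
      case (yes p₁₂≡0) (yes p₀₂≡0) = ¬coords≡0 ℓ (fromSixPairs (λ i j → coords ℓ i j ≡ 0#) (coords-diag ℓ)
        (coords≡0-flip ℓ)
        p₀₁≡0 p₀₂≡0 p₀₃≡0 p₁₂≡0 p₁₃≡0 p₂₃≡0)

    -- With t = -p₀₁/p₀₃, the isotropy and Klein relations force the coordinates (-t, ·, 1, t², 0, t) · p₀₃.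
    shape-p₁₃≡0 : Shape ℓ
    shape-p₁₃≡0 = case (t ≟ 0#) (t ≟ 1#) (a₀₂ ≟ 0#)
      where
      z t : Carrier
      z = a₀₃ ⁻¹
      t = - a₀₁ * z
      a₀₃z≡1 : a₀₃ * z - 1# ≡ 0#
      a₀₃z≡1 = x≡y⇒x-y≡0 (⁻¹-inverse a₀₃ p₀₃≢0)
      p₀₁≡ : a₀₁ ≡ - (t * a₀₃)
      p₀₁≡ = x-y≡0⇒x≡y (trans
        (solve 3 (λ a₀₁ a₀₃ z → a₀₁ :- :- (:- a₀₁ :* z :* a₀₃) := (:- a₀₁) :* (a₀₃ :* z :- :1)) refl a₀₁ a₀₃ z)
        (*-vanish a₀₃z≡1))
      p₂₃≡ : a₂₃ ≡ t * a₀₃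
      p₂₃≡ = x-y≡0⇒x≡y (trans
        (solve 4 (λ a₀₁ a₂₃ a₀₃ z → a₂₃ :- (:- a₀₁ :* z) :* a₀₃ := :1 :* (a₀₁ :+ a₂₃) :+ a₀₁ :* (a₀₃ :* z :- :1))
           refl a₀₁ a₂₃ a₀₃ z)
        (*+-vanish (p₀₁+p₂₃≡0 ℓ) (*-vanish a₀₃z≡1)))
      p₁₂≡ : a₁₂ ≡ t * t * a₀₃
      p₁₂≡ = x-y≡0⇒x≡y (x*y≡0⇒y≡0 p₀₃≢0 (trans
        (solve 7 (λ a₀₁ a₀₂ a₀₃ a₁₂ a₁₃ a₂₃ z →
           a₀₃ :* (a₁₂ :- (:- a₀₁ :* z) :* (:- a₀₁ :* z) :* a₀₃)
             := :1 :* (a₀₁ :* a₂₃ :- a₀₂ :* a₁₃ :+ a₀₃ :* a₁₂) :+ ((:- a₀₁) :* (a₀₁ :+ a₂₃) :+ (a₀₂ :* a₁₃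
                :+ (:- (a₀₁ :* a₀₁ :* (a₀₃ :* z :+ :1))) :* (a₀₃ :* z :- :1)))) refl a₀₁ a₀₂ a₀₃ a₁₂ (p₁₃ ℓ) a₂₃ z)
        (*+-vanish (klein-relation ℓ) (*+-vanish (p₀₁+p₂₃≡0 ℓ) (*+-vanish p₁₃≡0 (*-vanish a₀₃z≡1))))))
      at : ∀ {s} → t ≡ s → (a₀₁ ≡ - (s * a₀₃)) × (a₁₂ ≡ s * s * a₀₃) × (a₂₃ ≡ s * a₀₃)
      at refl = p₀₁≡ , p₁₂≡ , p₂₃≡
      case : Dec (t ≡ 0#) → Dec (t ≡ 1#) → Dec (a₀₂ ≡ 0#) → Shape ℓ
      case (yes t≡0) _ (yes p₀₂≡0) = let e₀₁ , e₁₂ , e₂₃ = at t≡0 in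
        e₀e₃ (trans e₀₁ (trans (cong -_ (zeroˡ a₀₃)) -0#≈0#)) p₀₂≡0 (trans e₁₂ (trans (cong (_* a₀₃) (zeroˡ 0#)) (zeroˡ a₀₃)))
             p₁₃≡0 (trans e₂₃ (zeroˡ a₀₃)) p₀₃≢0
      case (yes t≡0) _ (no p₀₂≢0) = let e₀₁ , e₁₂ , e₂₃ = at t≡0 in
        ⊥-elim (≉L₀ _ (≈L₀ ℓ (trans e₀₁ (trans (cong -_ (zeroˡ a₀₃)) -0#≈0#)) (trans e₁₂ (trans (cong (_* a₀₃) (zeroˡ 0#)) (zeroˡ a₀₃)))
                        p₁₃≡0 (trans e₂₃ (zeroˡ a₀₃)) p₀₂≢0))
      case (no t≢0) (yes t≡1) _ = let e₀₁ , e₁₂ , e₂₃ = at t≡1 in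
        ⊥-elim (≉Lʸ _ (≈Lʸ ℓ (trans e₀₁ (cong -_ (*-identityˡ a₀₃))) (trans e₁₂ (trans (cong (_* a₀₃) (*-identityˡ 1#)) (*-identityˡ a₀₃)))
                        p₁₃≡0 (trans e₂₃ (*-identityˡ a₀₃)) p₀₃≢0))
      case (no t≢0) (no t≢1) _ = through t t≢0 t≢1 p₀₃≢0 p₁₃≡0 p₀₁≡ p₁₂≡ p₂₃≡

  shape : ∀ {ℓ} → Outside ℓ → Shape ℓ
  shape {ℓ} outside with p₁₃ ℓ ≟ 0#
  ... | no p₁₃≢0 = generic p₁₃≢0
  ... | yes p₁₃≡0 = shape-p₁₃≡0 outside p₁₃≡0

  module _ {ℓ ℓ′ : Line} (ℓ⊑ℓ′ : ℓ ⊑ ℓ′) where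
    open _⊑_ ℓ⊑ℓ′

    L₀-roots : ∀ t → p₁₃ ℓ ≡ t * p₁₂ ℓ → p₁₃ ℓ′ ≡ t * p₁₂ ℓ′
    L₀-roots t = sym ∘ to (meets-L₀ ℓ′ t) ∘ via-L₀ t ∘ from (meets-L₀ ℓ t) ∘ sym

    L₁-roots : ∀ t → t ≢ 0# → p₀₃ ℓ ≡ t * p₀₂ ℓ → p₀₃ ℓ′ ≡ t * p₀₂ ℓ′
    L₁-roots t t≢0 = to (meets-L₁ ℓ′ t) ∘ via-L₁ t t≢0 ∘ from (meets-L₁ ℓ t)

    L₂-roots : ∀ t → p₀₃ ℓ ≡ t * p₁₃ ℓ → p₀₃ ℓ′ ≡ t * p₁₃ ℓ′
    L₂-roots t = to (meets-L₂ ℓ′ t) ∘ via-L₂ t ∘ from (meets-L₂ ℓ t)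

    Lʸ-roots : ∀ t → Y ℓ ≡ t * p₁₃ ℓ → Y ℓ′ ≡ t * p₁₃ ℓ′
    Lʸ-roots t = to (meets-Lʸ ℓ′ t) ∘ via-Lʸ t ∘ from (meets-Lʸ ℓ t)

    p₁₃≡0-transfer : p₁₃ ℓ ≡ 0# → p₁₃ ℓ′ ≡ 0#
    p₁₃≡0-transfer p₁₃≡0 = trans (L₀-roots 0# (trans p₁₃≡0 (sym (zeroˡ _)))) (zeroˡ _)

    e₀e₃-⋢-through : p₁₂ ℓ ≡ 0# → p₁₃ ℓ ≡ 0# →
                     ∀ {t′} → t′ ≢ 0# → p₀₃ ℓ′ ≢ 0# → p₁₃ ℓ′ ≡ 0# → p₁₂ ℓ′ ≢ t′ * t′ * p₀₃ ℓ′
    e₀e₃-⋢-through p₁₂≡0 p₁₃≡0 {t′} t′≢0 p₀₃′≢0 p₁₃′≡0 p₁₂′≡ =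
      t′≢0 (x*x≡0⇒x≡0 (x*y≡0⇒y≡0 p₀₃′≢0 (trans (*-comm _ _) (trans (sym p₁₂′≡) p₁₂′≡0))))
      where
      p₁₂′≡0 : p₁₂ ℓ′ ≡ 0#
      p₁₂′≡0 = trans (sym (*-identityˡ _)) (trans (sym (L₀-roots 1# (trans p₁₃≡0 (sym (trans (*-identityˡ _) p₁₂≡0))))) p₁₃′≡0)

    -- The point e₀ + t e₂ of ℓ lies on ℓ′ too, which pins down the parameter of ℓ′.
    same-parameter : ∀ {t t′} → t ≢ 0# → t ≢ 1# → t ≢ 2# → p₀₃ ℓ ≢ 0# → p₁₃ ℓ ≡ 0# → p₂₃ ℓ ≡ t * p₀₃ ℓ →
      p₀₃ ℓ′ ≢ 0# → p₂₃ ℓ′ ≡ t′ * p₀₃ ℓ′ → t ≡ t′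
    same-parameter {t} t≢0 t≢1 t≢2 p₀₃≢0 p₁₃≡0 p₂₃≡ p₀₃′≢0 p₂₃′≡ = *-cancelˡ p₀₃′≢0
      (trans (*-comm _ _) (trans (sym (incident-onL₀ ℓ′ t (via-onL₀ t t≢0 t≢1 t≢2 (onL₀-incident ℓ t p₀₃≢0 p₁₃≡0 p₂₃≡))))
                                 (trans p₂₃′≡ (*-comm _ _))))

  -- With λ = b₁₃/a₁₃ the hypotheses give b₁₂, b₀₃ and the Lʸ-combination as λ times those of a;
  -- isotropy then yields b₀₁ and b₂₃ (dividing by 2), and the Klein relation b₀₂.
  proportional-by-ratios : ∀ {a₀₁ a₀₂ a₀₃ a₁₂ a₁₃ a₂₃ b₀₁ b₀₂ b₀₃ b₁₂ b₁₃ b₂₃} → 2# ≢ 0# → a₁₃ ≢ 0# → b₁₃ ≢ 0# →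
    a₀₁ + a₂₃ ≡ 0# → b₀₁ + b₂₃ ≡ 0# →
    a₀₁ * a₂₃ - a₀₂ * a₁₃ + a₀₃ * a₁₂ ≡ 0# → b₀₁ * b₂₃ - b₀₂ * b₁₃ + b₀₃ * b₁₂ ≡ 0# →
    a₁₃ * b₁₂ ≡ b₁₃ * a₁₂ → a₁₃ * b₀₃ ≡ b₁₃ * a₀₃ → (a₀₁ - a₂₃ + a₀₃ + a₁₂) * b₁₃ ≡ (b₀₁ - b₂₃ + b₀₃ + b₁₂) * a₁₃ →
    (a₁₃ * b₀₁ ≡ b₁₃ * a₀₁) × (a₁₃ * b₀₂ ≡ b₁₃ * a₀₂) × (a₁₃ * b₂₃ ≡ b₁₃ * a₂₃)
  proportional-by-ratios {a₀₁} {a₀₂} {a₀₃} {a₁₂} {a₁₃} {a₂₃} {b₀₁} {b₀₂} {b₀₃} {b₁₂} {b₁₃} {b₂₃}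
    2≢0 a₁₃≢0 b₁₃≢0 isoᵃ isoᵇ kleinᵃ kleinᵇ r₁₂ r₀₃ rʸ = r₀₁ , r₀₂ , r₂₃
    where
    r₀₁ : a₁₃ * b₀₁ ≡ b₁₃ * a₀₁
    r₀₁ = x-y≡0⇒x≡y (x*y≡0⇒y≡0 2≢0 (trans
      (solve 12 (λ a₀₁ a₀₂ a₀₃ a₁₂ a₁₃ a₂₃ b₀₁ b₀₂ b₀₃ b₁₂ b₁₃ b₂₃ →
         (:1 :+ :1) :* (a₁₃ :* b₀₁ :- b₁₃ :* a₀₁)
           := (:- :1) :* ((a₀₁ :- a₂₃ :+ a₀₃ :+ a₁₂) :* b₁₃ :- (b₀₁ :- b₂₃ :+ b₀₃ :+ b₁₂) :* a₁₃)
              :+ ((:- b₁₃) :* (a₀₁ :+ a₂₃) :+ (a₁₃ :* (b₀₁ :+ b₂₃)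
              :+ ((:- :1) :* (a₁₃ :* b₀₃ :- b₁₃ :* a₀₃) :+ (:- :1) :* (a₁₃ :* b₁₂ :- b₁₃ :* a₁₂)))))
         refl a₀₁ a₀₂ a₀₃ a₁₂ a₁₃ a₂₃ b₀₁ b₀₂ b₀₃ b₁₂ b₁₃ b₂₃)
      (*+-vanish (x≡y⇒x-y≡0 rʸ) (*+-vanish isoᵃ (*+-vanish isoᵇ (*+-vanish (x≡y⇒x-y≡0 r₀₃) (*-vanish (x≡y⇒x-y≡0 r₁₂))))))))
    r₂₃ : a₁₃ * b₂₃ ≡ b₁₃ * a₂₃
    r₂₃ = x-y≡0⇒x≡y (trans
      (solve 6 (λ a₀₁ a₁₃ a₂₃ b₀₁ b₁₃ b₂₃ →
         a₁₃ :* b₂₃ :- b₁₃ :* a₂₃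
           := a₁₃ :* (b₀₁ :+ b₂₃) :+ ((:- b₁₃) :* (a₀₁ :+ a₂₃) :+ (:- :1) :* (a₁₃ :* b₀₁ :- b₁₃ :* a₀₁)))
         refl a₀₁ a₁₃ a₂₃ b₀₁ b₁₃ b₂₃)
      (*+-vanish isoᵇ (*+-vanish isoᵃ (*-vanish (x≡y⇒x-y≡0 r₀₁)))))
    r₀₂ : a₁₃ * b₀₂ ≡ b₁₃ * a₀₂
    r₀₂ = x-y≡0⇒x≡y (x*y≡0⇒y≡0 (*-≢0 a₁₃≢0 b₁₃≢0) (trans
      (solve 12 (λ a₀₁ a₀₂ a₀₃ a₁₂ a₁₃ a₂₃ b₀₁ b₀₂ b₀₃ b₁₂ b₁₃ b₂₃ →
         a₁₃ :* b₁₃ :* (a₁₃ :* b₀₂ :- b₁₃ :* a₀₂)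
           := a₁₃ :* a₁₃ :* b₀₁ :* (b₀₁ :+ b₂₃)
              :+ ((:- ((:1 :+ :1) :* b₁₃ :* a₀₁ :+ (a₁₃ :* b₀₁ :- b₁₃ :* a₀₁))) :* (a₁₃ :* b₀₁ :- b₁₃ :* a₀₁)
              :+ ((b₁₃ :* a₀₃ :+ (a₁₃ :* b₀₃ :- b₁₃ :* a₀₃)) :* (a₁₃ :* b₁₂ :- b₁₃ :* a₁₂)
              :+ (b₁₃ :* a₁₂ :* (a₁₃ :* b₀₃ :- b₁₃ :* a₀₃)
              :+ ((:- (a₁₃ :* a₁₃)) :* (b₀₁ :* b₂₃ :- b₀₂ :* b₁₃ :+ b₀₃ :* b₁₂)
              :+ ((:- (b₁₃ :* b₁₃ :* a₀₁)) :* (a₀₁ :+ a₂₃)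
              :+ b₁₃ :* b₁₃ :* (a₀₁ :* a₂₃ :- a₀₂ :* a₁₃ :+ a₀₃ :* a₁₂)))))))
         refl a₀₁ a₀₂ a₀₃ a₁₂ a₁₃ a₂₃ b₀₁ b₀₂ b₀₃ b₁₂ b₁₃ b₂₃)
      (*+-vanish isoᵇ (*+-vanish (x≡y⇒x-y≡0 r₀₁) (*+-vanish (x≡y⇒x-y≡0 r₁₂) (*+-vanish (x≡y⇒x-y≡0 r₀₃)
        (*+-vanish kleinᵇ (*+-vanish isoᵃ (*-vanish kleinᵃ)))))))))

  generic-≈L : ∀ {ℓ ℓ′} → 2# ≢ 0# → ℓ ⊑ ℓ′ → ℓ′ ⊑ ℓ → p₁₃ ℓ ≢ 0# → p₁₃ ℓ′ ≢ 0# → ℓ ≈L ℓ′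
  generic-≈L {ℓ} {ℓ′} 2≢0 ℓ⊑ℓ′ ℓ′⊑ℓ a₁₃≢0 b₁₃≢0 =
    let r₀₁ , r₀₂ , r₂₃ = proportional-by-ratios 2≢0 a₁₃≢0 b₁₃≢0 (p₀₁+p₂₃≡0 ℓ) (p₀₁+p₂₃≡0 ℓ′)
                            (klein-relation ℓ) (klein-relation ℓ′) r₁₂ r₀₃ rʸ
    in proportional⇒≈L {p₁₃ ℓ} {p₁₃ ℓ′} {ℓ} {ℓ′} a₁₃≢0 b₁₃≢0 r₀₁ r₀₂ r₀₃ r₁₂ (*-comm _ _) r₂₃
    where
    r₁₂ : p₁₃ ℓ * p₁₂ ℓ′ ≡ p₁₃ ℓ′ * p₁₂ ℓ
    r₁₂ = nonzero-roots-agree a₁₃≢0 b₁₃≢0 (λ t _ → L₀-roots ℓ⊑ℓ′ t) (λ t _ → L₀-roots ℓ′⊑ℓ t)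
    r₀₃ : p₁₃ ℓ * p₀₃ ℓ′ ≡ p₁₃ ℓ′ * p₀₃ ℓ
    r₀₃ = trans (*-comm _ _) (trans (sym (root-transfer a₁₃≢0 (L₂-roots ℓ⊑ℓ′))) (*-comm _ _))
    rʸ : Y ℓ * p₁₃ ℓ′ ≡ Y ℓ′ * p₁₃ ℓ
    rʸ = root-transfer a₁₃≢0 (Lʸ-roots ℓ⊑ℓ′)

  private
    by-p₀₃ : ∀ {ℓ ℓ′} → p₀₃ ℓ ≢ 0# → p₀₃ ℓ′ ≢ 0# →
      p₀₃ ℓ * p₀₁ ℓ′ ≡ p₀₃ ℓ′ * p₀₁ ℓ → p₀₃ ℓ * p₀₂ ℓ′ ≡ p₀₃ ℓ′ * p₀₂ ℓ → p₀₃ ℓ * p₁₂ ℓ′ ≡ p₀₃ ℓ′ * p₁₂ ℓ →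
      p₀₃ ℓ * p₁₃ ℓ′ ≡ p₀₃ ℓ′ * p₁₃ ℓ → p₀₃ ℓ * p₂₃ ℓ′ ≡ p₀₃ ℓ′ * p₂₃ ℓ → ℓ ≈L ℓ′
    by-p₀₃ {ℓ} {ℓ′} a₀₃≢0 b₀₃≢0 r₀₁ r₀₂ r₁₂ r₁₃ r₂₃ =
      proportional⇒≈L {p₀₃ ℓ} {p₀₃ ℓ′} {ℓ} {ℓ′} a₀₃≢0 b₀₃≢0 r₀₁ r₀₂ (*-comm _ _) r₁₂ r₁₃ r₂₃

    both≡0 : ∀ {a b x y} → x ≡ 0# → y ≡ 0# → a * x ≡ b * y
    both≡0 x≡0 y≡0 = trans (*-vanish x≡0) (sym (*-vanish y≡0))

    both-scaled : ∀ {a b c x y} → x ≡ c * b → y ≡ c * a → a * x ≡ b * y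
    both-scaled {a} {b} {c} refl refl = solve 3 (λ a b c → a :* (c :* b) := b :* (c :* a)) refl a b c

  e₀e₃-≈L : ∀ {ℓ ℓ′} → p₀₁ ℓ ≡ 0# → p₀₂ ℓ ≡ 0# → p₁₂ ℓ ≡ 0# → p₁₃ ℓ ≡ 0# → p₂₃ ℓ ≡ 0# → p₀₃ ℓ ≢ 0# →
    p₀₁ ℓ′ ≡ 0# → p₀₂ ℓ′ ≡ 0# → p₁₂ ℓ′ ≡ 0# → p₁₃ ℓ′ ≡ 0# → p₂₃ ℓ′ ≡ 0# → p₀₃ ℓ′ ≢ 0# → ℓ ≈L ℓ′
  e₀e₃-≈L {ℓ} {ℓ′} a₀₁≡0 a₀₂≡0 a₁₂≡0 a₁₃≡0 a₂₃≡0 a₀₃≢0 b₀₁≡0 b₀₂≡0 b₁₂≡0 b₁₃≡0 b₂₃≡0 b₀₃≢0 =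
    by-p₀₃ {ℓ} {ℓ′} a₀₃≢0 b₀₃≢0 (both≡0 b₀₁≡0 a₀₁≡0) (both≡0 b₀₂≡0 a₀₂≡0) (both≡0 b₁₂≡0 a₁₂≡0)
                                (both≡0 b₁₃≡0 a₁₃≡0) (both≡0 b₂₃≡0 a₂₃≡0)

  through-≈L : ∀ {ℓ ℓ′ t} → ℓ ⊑ ℓ′ → ℓ′ ⊑ ℓ →
    p₀₃ ℓ ≢ 0# → p₁₃ ℓ ≡ 0# → p₀₁ ℓ ≡ - (t * p₀₃ ℓ) → p₁₂ ℓ ≡ t * t * p₀₃ ℓ → p₂₃ ℓ ≡ t * p₀₃ ℓ →
    p₀₃ ℓ′ ≢ 0# → p₁₃ ℓ′ ≡ 0# → p₀₁ ℓ′ ≡ - (t * p₀₃ ℓ′) → p₁₂ ℓ′ ≡ t * t * p₀₃ ℓ′ → p₂₃ ℓ′ ≡ t * p₀₃ ℓ′ → ℓ ≈L ℓ′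
  through-≈L {ℓ} {ℓ′} ℓ⊑ℓ′ ℓ′⊑ℓ a₀₃≢0 a₁₃≡0 a₀₁≡ a₁₂≡ a₂₃≡ b₀₃≢0 b₁₃≡0 b₀₁≡ b₁₂≡ b₂₃≡ =
    by-p₀₃ {ℓ} {ℓ′} a₀₃≢0 b₀₃≢0
      (trans (cong (p₀₃ ℓ *_) b₀₁≡) (trans (sym (-‿distribʳ-* _ _)) (trans (cong -_ (both-scaled refl refl))
             (trans (-‿distribʳ-* _ _) (cong (p₀₃ ℓ′ *_) (sym a₀₁≡))))))
      (nonzero-roots-agree a₀₃≢0 b₀₃≢0 (L₁-roots ℓ⊑ℓ′) (L₁-roots ℓ′⊑ℓ))
      (both-scaled b₁₂≡ a₁₂≡) (both≡0 b₁₃≡0 a₁₃≡0) (both-scaled b₂₃≡ a₂₃≡)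

  ⊑-antisym : ∀ {ℓ ℓ′} → 2# ≢ 0# → Outside ℓ → Outside ℓ′ → ℓ ⊑ ℓ′ → ℓ′ ⊑ ℓ → ℓ ≈L ℓ′
  ⊑-antisym {ℓ} {ℓ′} 2≢0 outside outside′ ℓ⊑ℓ′ ℓ′⊑ℓ = compare (shape outside) (shape outside′)
    where
    parameter : ∀ {t t′} → t ≢ 0# → t ≢ 1# → t′ ≢ 0# → t′ ≢ 1# → p₀₃ ℓ ≢ 0# → p₁₃ ℓ ≡ 0# → p₂₃ ℓ ≡ t * p₀₃ ℓ →
                p₀₃ ℓ′ ≢ 0# → p₁₃ ℓ′ ≡ 0# → p₂₃ ℓ′ ≡ t′ * p₀₃ ℓ′ → t ≡ t′
    parameter {t} {t′} t≢0 t≢1 t′≢0 t′≢1 a₀₃≢0 a₁₃≡0 a₂₃≡ b₀₃≢0 b₁₃≡0 b₂₃≡ = case (t ≟ 2#) (t′ ≟ 2#)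
      where
      case : Dec (t ≡ 2#) → Dec (t′ ≡ 2#) → t ≡ t′
      case (no t≢2) _ = same-parameter ℓ⊑ℓ′ t≢0 t≢1 t≢2 a₀₃≢0 a₁₃≡0 a₂₃≡ b₀₃≢0 b₂₃≡
      case (yes _) (no t′≢2) = sym (same-parameter ℓ′⊑ℓ t′≢0 t′≢1 t′≢2 b₀₃≢0 b₁₃≡0 b₂₃≡ a₀₃≢0 a₂₃≡)
      case (yes t≡2) (yes t′≡2) = trans t≡2 (sym t′≡2)
    compare : Shape ℓ → Shape ℓ′ → ℓ ≈L ℓ′
    compare (generic a₁₃≢0) (generic b₁₃≢0) = generic-≈L 2≢0 ℓ⊑ℓ′ ℓ′⊑ℓ a₁₃≢0 b₁₃≢0
    compare (generic a₁₃≢0) (e₀e₃ _ _ _ b₁₃≡0 _ _) = ⊥-elim (a₁₃≢0 (p₁₃≡0-transfer ℓ′⊑ℓ b₁₃≡0))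
    compare (generic a₁₃≢0) (through _ _ _ _ b₁₃≡0 _ _ _) = ⊥-elim (a₁₃≢0 (p₁₃≡0-transfer ℓ′⊑ℓ b₁₃≡0))
    compare (e₀e₃ _ _ _ a₁₃≡0 _ _) (generic b₁₃≢0) = ⊥-elim (b₁₃≢0 (p₁₃≡0-transfer ℓ⊑ℓ′ a₁₃≡0))
    compare (through _ _ _ _ a₁₃≡0 _ _ _) (generic b₁₃≢0) = ⊥-elim (b₁₃≢0 (p₁₃≡0-transfer ℓ⊑ℓ′ a₁₃≡0))
    compare (e₀e₃ a₀₁≡0 a₀₂≡0 a₁₂≡0 a₁₃≡0 a₂₃≡0 a₀₃≢0) (e₀e₃ b₀₁≡0 b₀₂≡0 b₁₂≡0 b₁₃≡0 b₂₃≡0 b₀₃≢0) =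
      e₀e₃-≈L {ℓ} {ℓ′} a₀₁≡0 a₀₂≡0 a₁₂≡0 a₁₃≡0 a₂₃≡0 a₀₃≢0 b₀₁≡0 b₀₂≡0 b₁₂≡0 b₁₃≡0 b₂₃≡0 b₀₃≢0
    compare (e₀e₃ _ _ a₁₂≡0 a₁₃≡0 _ _) (through _ t′≢0 _ b₀₃≢0 b₁₃≡0 _ b₁₂≡ _) =
      ⊥-elim (e₀e₃-⋢-through ℓ⊑ℓ′ a₁₂≡0 a₁₃≡0 t′≢0 b₀₃≢0 b₁₃≡0 b₁₂≡)
    compare (through _ t≢0 _ a₀₃≢0 a₁₃≡0 _ a₁₂≡ _) (e₀e₃ _ _ b₁₂≡0 b₁₃≡0 _ _) =
      ⊥-elim (e₀e₃-⋢-through ℓ′⊑ℓ b₁₂≡0 b₁₃≡0 t≢0 a₀₃≢0 a₁₃≡0 a₁₂≡)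
    compare (through t t≢0 t≢1 a₀₃≢0 a₁₃≡0 a₀₁≡ a₁₂≡ a₂₃≡) (through t′ t′≢0 t′≢1 b₀₃≢0 b₁₃≡0 b₀₁≡ b₁₂≡ b₂₃≡)
      with parameter t≢0 t≢1 t′≢0 t′≢1 a₀₃≢0 a₁₃≡0 a₂₃≡ b₀₃≢0 b₁₃≡0 b₂₃≡
    ... | refl = through-≈L ℓ⊑ℓ′ ℓ′⊑ℓ a₀₃≢0 a₁₃≡0 a₀₁≡ a₁₂≡ a₂₃≡ b₀₃≢0 b₁₃≡0 b₀₁≡ b₁₂≡ b₂₃≡

module Construction (F : FiniteField) (2≢0 : FieldTheory.2# F ≢ FieldTheory.0# F) where
  open FieldTheory F
  open Lines F
  open IncidenceGraph F
  open Configuration F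
  open Removal _≟_

  nonzero parameters : List Carrier
  nonzero = without 0# elements
  parameters = without 2# (without 1# nonzero)

  configurationLines : List Line
  configurationLines = map L₀ elements ++ map L₂ elements ++ map Lʸ elements ++ map L₁ nonzero

  configurationPoints : List Point
  configurationPoints = map onL₀ parameters

  S : List Vertex
  S = map inj₂ configurationLines ++ map inj₁ configurationPoints

  L₀∈S : ∀ t → inj₂ (L₀ t) ∈ S
  L₀∈S t = ∈-++⁺ˡ (∈-map⁺ inj₂ (∈-++⁺ˡ (∈-map⁺ L₀ (elements-complete t))))

  L₂∈S : ∀ t → inj₂ (L₂ t) ∈ S
  L₂∈S t = ∈-++⁺ˡ (∈-map⁺ inj₂ (∈-++⁺ʳ (map L₀ elements) (∈-++⁺ˡ (∈-map⁺ L₂ (elements-complete t)))))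

  Lʸ∈S : ∀ t → inj₂ (Lʸ t) ∈ S
  Lʸ∈S t = ∈-++⁺ˡ (∈-map⁺ inj₂ (∈-++⁺ʳ (map L₀ elements) (∈-++⁺ʳ (map L₂ elements) (∈-++⁺ˡ (∈-map⁺ Lʸ (elements-complete t))))))

  L₁∈S : ∀ t → t ≢ 0# → inj₂ (L₁ t) ∈ S
  L₁∈S t t≢0 = ∈-++⁺ˡ (∈-map⁺ inj₂ (∈-++⁺ʳ (map L₀ elements) (∈-++⁺ʳ (map L₂ elements) (∈-++⁺ʳ (map Lʸ elements)
    (∈-map⁺ L₁ (∈-without⁺ (elements-complete t) t≢0))))))

  onL₀∈S : ∀ t → t ≢ 0# → t ≢ 1# → t ≢ 2# → inj₁ (onL₀ t) ∈ S
  onL₀∈S t t≢0 t≢1 t≢2 = ∈-++⁺ʳ (map inj₂ configurationLines)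
    (∈-map⁺ inj₁ (∈-map⁺ onL₀ (∈-without⁺ (∈-without⁺ (∈-without⁺ (elements-complete t) t≢0) t≢1) t≢2)))

  separates-sym : ∀ {ℓ ℓ′} x → Separates ℓ ℓ′ x → Separates ℓ′ ℓ x
  separates-sym (inj₁ P) = Sum.swap
  separates-sym (inj₂ m) (inj₁ s) = inj₂ (inj₁ s)
  separates-sym (inj₂ m) (inj₂ (inj₁ s)) = inj₁ s
  separates-sym (inj₂ m) (inj₂ (inj₂ (ℓ≉m , ℓ′≉m , s))) = inj₂ (inj₂ (ℓ′≉m , ℓ≉m , Sum.swap s))

  module Unseparated {ℓ ℓ′} (ℓ≉ℓ′ : ¬ ℓ ≈L ℓ′) (unseparated : ∀ x → x ∈ S → ¬ Separates ℓ ℓ′ x) where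
    ≉S : ∀ m → inj₂ m ∈ S → ¬ ℓ ≈L m
    ≉S m m∈S ℓ≈m = case (ℓ′ ≈L? m)
      where
      case : Dec (ℓ′ ≈L m) → ⊥
      case (yes ℓ′≈m) = ℓ≉ℓ′ (≈L-trans {ℓ} {m} {ℓ′} ℓ≈m (≈L-sym {ℓ′} {m} ℓ′≈m))
      case (no ℓ′≉m) = unseparated (inj₂ m) m∈S (inj₁ (ℓ≈m , ℓ′≉m))

    outside : Outside ℓ
    outside = record { ≉L₀ = λ t → ≉S (L₀ t) (L₀∈S t) ; ≉L₂ = λ t → ≉S (L₂ t) (L₂∈S t) ; ≉Lʸ = λ t → ≉S (Lʸ t) (Lʸ∈S t) }

    meets-transfer : ∀ m → inj₂ m ∈ S → Meets ℓ m → Meets ℓ′ m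
    meets-transfer m m∈S ℓ∩m = case (meets? ℓ′ m)
      where
      ℓ′≉m : ¬ ℓ′ ≈L m
      ℓ′≉m ℓ′≈m = case′ (ℓ ≈L? m)
        where
        case′ : Dec (ℓ ≈L m) → ⊥
        case′ (yes ℓ≈m) = ≉S m m∈S ℓ≈m
        case′ (no ℓ≉m) = unseparated (inj₂ m) m∈S (inj₂ (inj₁ (ℓ′≈m , ℓ≉m)))
      case : Dec (Meets ℓ′ m) → Meets ℓ′ m
      case (yes ℓ′∩m) = ℓ′∩m
      case (no ¬ℓ′∩m) = ⊥-elim (unseparated (inj₂ m) m∈S (inj₂ (inj₂ (≉S m m∈S , ℓ′≉m , inj₁ (ℓ∩m , ¬ℓ′∩m)))))

    incident-transfer : ∀ P → inj₁ P ∈ S → P I ℓ → P I ℓ′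
    incident-transfer P P∈S P∈ℓ = case (inSpan? ℓ′ (Point.vec P))
      where
      case : Dec (P I ℓ′) → P I ℓ′
      case (yes P∈ℓ′) = P∈ℓ′
      case (no P∉ℓ′) = ⊥-elim (unseparated (inj₁ P) P∈S (inj₁ (P∈ℓ , P∉ℓ′)))

    ⊑ : ℓ ⊑ ℓ′
    ⊑ = record
      { via-L₀ = λ t → meets-transfer (L₀ t) (L₀∈S t)
      ; via-L₁ = λ t t≢0 → meets-transfer (L₁ t) (L₁∈S t t≢0)
      ; via-L₂ = λ t → meets-transfer (L₂ t) (L₂∈S t)
      ; via-Lʸ = λ t → meets-transfer (Lʸ t) (Lʸ∈S t)
      ; via-onL₀ = λ t t≢0 t≢1 t≢2 → incident-transfer (onL₀ t) (onL₀∈S t t≢0 t≢1 t≢2)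
      }

  semiResolving : SemiResolvingForLines S
  semiResolving ℓ ℓ′ ℓ≉ℓ′ = case (any? (separates? ℓ ℓ′) S)
    where
    case : Dec (Any (Separates ℓ ℓ′) S) → ∃[ x ] (x ∈ S × Distinguishes x (inj₂ ℓ) (inj₂ ℓ′))
    case (yes some) = let x , x∈S , separates = find some in x , x∈S , separates⇒distinguishes ℓ ℓ′ x separates
    case (no none) = ⊥-elim (ℓ≉ℓ′ (⊑-antisym 2≢0 (U.outside) (U′.outside) U.⊑ U′.⊑))
      where
      unseparated : ∀ x → x ∈ S → ¬ Separates ℓ ℓ′ x
      unseparated x x∈S = none ∘ lose x∈S
      module U = Unseparated ℓ≉ℓ′ unseparated
      module U′ = Unseparated (ℓ≉ℓ′ ∘ ≈L-sym {ℓ′} {ℓ}) (λ x x∈S → unseparated x x∈S ∘ separates-sym x)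

  private
    1≢a*0+b*0 : ∀ {a b} → 1# ≢ a * 0# + b * 0#
    1≢a*0+b*0 {a} {b} 1≡ = 1≢0 (trans 1≡ (trans (lin-0ˡ a b 0#) (zeroʳ b)))

  L₀-injective : ∀ {t s} → L₀ t ≈L L₀ s → t ≡ s
  L₀-injective {t} {s} L₀t≈L₀s = let a , b , w≡ = to (L₀t≈L₀s _) (v∈L (L₀ t)) in
    trans (w≡ 3F) (trans (lin-0ˡ a b s) (trans (cong (_* s) (sym (trans (w≡ 2F) (trans (lin-0ˡ a b 1#) (*-identityʳ b))))) (*-identityˡ s)))

  L₁-injective : ∀ {t s} → L₁ t ≈L L₁ s → t ≡ s
  L₁-injective {t} {s} L₁t≈L₁s = let a , b , w≡ = to (L₁t≈L₁s _) (v∈L (L₁ t)) in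
    trans (w≡ 3F) (trans (lin-0ˡ a b s) (trans (cong (_* s) (sym (trans (w≡ 2F) (trans (lin-0ˡ a b 1#) (*-identityʳ b))))) (*-identityˡ s)))

  L₂-injective : ∀ {t s} → L₂ t ≈L L₂ s → t ≡ s
  L₂-injective {t} {s} L₂t≈L₂s = let a , b , w≡ = to (L₂t≈L₂s _) (u∈L (L₂ t)) in
    trans (w≡ 0F) (trans (lin-0ʳ a b s) (trans (cong (_* s) (sym (trans (w≡ 1F) (trans (lin-0ʳ a b 1#) (*-identityʳ a))))) (*-identityˡ s)))

  Lʸ-injective : ∀ {t s} → Lʸ t ≈L Lʸ s → t ≡ s
  Lʸ-injective {t} {s} Lʸt≈Lʸs = let a , b , w≡ = to (Lʸt≈Lʸs _) (u∈L (Lʸ t)) in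
    trans (w≡ 0F) (trans (cong₂ (λ x y → x * s + y * 1#) (sym (trans (w≡ 1F) (trans (lin-0ʳ a b 1#) (*-identityʳ a))))
                                                       (sym (trans (w≡ 2F) (trans (lin-0ˡ a b 1#) (*-identityʳ b)))))
                  (trans (cong (1# * s +_) (zeroˡ 1#)) (trans (+-identityʳ _) (*-identityˡ s))))

  L₀≉L₂ : ∀ {t s} → ¬ L₀ t ≈L L₂ s
  L₀≉L₂ {t} {s} L₀≈L₂ = let a , b , w≡ = from (L₀≈L₂ _) (u∈L (L₂ s)) in 1≢a*0+b*0 (w≡ 1F)

  L₀≉Lʸ : ∀ {t s} → ¬ L₀ t ≈L Lʸ s
  L₀≉Lʸ {t} {s} L₀≈Lʸ = let a , b , w≡ = from (L₀≈Lʸ _) (u∈L (Lʸ s)) in 1≢a*0+b*0 (w≡ 1F)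

  L₀≉L₁ : ∀ {t s} → ¬ L₀ t ≈L L₁ s
  L₀≉L₁ {t} {s} L₀≈L₁ = let a , b , w≡ = from (L₀≈L₁ _) (u∈L (L₁ s)) in 1≢a*0+b*0 (w≡ 1F)

  L₂≉Lʸ : ∀ {t s} → ¬ L₂ t ≈L Lʸ s
  L₂≉Lʸ {t} {s} L₂≈Lʸ = let a , b , w≡ = from (L₂≈Lʸ _) (v∈L (Lʸ s)) in
    1≢0 (trans (w≡ 0F) (trans (lin-0ʳ a b t) (trans (cong (_* t) (sym (trans (w≡ 1F) (trans (lin-0ʳ a b 1#) (*-identityʳ a)))))
                                                   (zeroˡ t))))

  L₂≉L₁ : ∀ {t s} → s ≢ 0# → ¬ L₂ t ≈L L₁ s
  L₂≉L₁ {t} {s} s≢0 L₂≈L₁ = let a , b , w≡ = from (L₂≈L₁ _) (v∈L (L₁ s)) in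
    s≢0 (trans (w≡ 3F) (trans (lin-0ˡ a b 0#) (zeroʳ b)))

  Lʸ≉L₁ : ∀ {t s} → ¬ Lʸ t ≈L L₁ s
  Lʸ≉L₁ {t} {s} Lʸ≈L₁ = let a , b , w≡ = from (Lʸ≈L₁ _) (u∈L (L₁ s)) in
    1≢0 (trans (trans (w≡ 1F) (trans (lin-0ʳ a b 1#) (*-identityʳ a)))
               (-x≡0⇒x≡0 (sym (trans (w≡ 3F) (trans (lin-0ʳ a b (- 1#)) (trans (sym (-‿distribʳ-* a 1#)) (cong -_ (*-identityʳ a))))))))

  onL₀-injective : ∀ {t s} → onL₀ t ≈P onL₀ s → t ≡ s
  onL₀-injective {t} {s} (c , _ , t≡cs) = trans (t≡cs 2F) (trans (cong (_* s) c≡1) (*-identityˡ s))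
    where
    c≡1 : c ≡ 1#
    c≡1 = sym (trans (t≡cs 0F) (*-identityʳ c))

  private
    Apart : Line → Line → Set
    Apart L M = ¬ L ≈L M

    family-apart : ∀ (f : Carrier → Line) {xs} → (∀ {t s} → f t ≈L f s → t ≡ s) → Unique xs → AllPairs Apart (map f xs)
    family-apart f f-injective unique = AllPairsₚ.map⁺ (AllPairs.map (_∘ f-injective) unique)

    families-apart : ∀ (f g : Carrier → Line) {xs ys} → (∀ {t s} → t ∈ xs → s ∈ ys → Apart (f t) (g s)) →
                     All (λ L → All (Apart L) (map g ys)) (map f xs)
    families-apart f g apart = Allₚ.map⁺ (All.tabulate λ t∈xs → Allₚ.map⁺ (All.tabulate λ s∈ys → apart t∈xs s∈ys))

    _and_ : ∀ {xs ys zs : List Line} → All (λ L → All (Apart L) ys) xs → All (λ L → All (Apart L) zs) xs →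
            All (λ L → All (Apart L) (ys ++ zs)) xs
    p and q = All.zipWith (λ (p , q) → Allₚ.++⁺ p q) (p , q)

    nonzero-unique : Unique nonzero
    nonzero-unique = without-unique elements-unique

  lines-apart : AllPairs Apart configurationLines
  lines-apart =
    AllPairsₚ.++⁺ (family-apart L₀ L₀-injective elements-unique)
      (AllPairsₚ.++⁺ (family-apart L₂ L₂-injective elements-unique)
        (AllPairsₚ.++⁺ (family-apart Lʸ Lʸ-injective elements-unique) (family-apart L₁ L₁-injective nonzero-unique)
          (families-apart Lʸ L₁ {elements} {nonzero} λ _ _ → Lʸ≉L₁))
        (families-apart L₂ Lʸ {elements} {elements} (λ _ _ → L₂≉Lʸ)
         and families-apart L₂ L₁ {elements} {nonzero} (λ _ s∈ → L₂≉L₁ (proj₂ (∈-without⁻ elements s∈)))))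
      (families-apart L₀ L₂ {elements} {elements} (λ _ _ → L₀≉L₂)
       and (families-apart L₀ Lʸ {elements} {elements} (λ _ _ → L₀≉Lʸ)
       and families-apart L₀ L₁ {elements} {nonzero} (λ _ _ → L₀≉L₁)))

  distinct : Distinct S
  distinct = AllPairsₚ.++⁺ (AllPairsₚ.map⁺ lines-apart)
    (AllPairsₚ.map⁺ (AllPairsₚ.map⁺ (AllPairs.map (_∘ onL₀-injective) (without-unique (without-unique nonzero-unique)))))
    (Allₚ.map⁺ (All.tabulate λ _ → Allₚ.map⁺ (All.tabulate λ _ ())))

  pointsOf-S : pointsOf S ≡ configurationPoints
  pointsOf-S = trans (skip-lines configurationLines) (points configurationPoints)
    where
    skip-lines : ∀ ls {rest} → pointsOf (map inj₂ ls ++ rest) ≡ pointsOf rest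
    skip-lines [] = refl
    skip-lines (_ ∷ ls) = skip-lines ls
    points : ∀ ps → pointsOf (map inj₁ ps) ≡ ps
    points [] = refl
    points (P ∷ ps) = cong (P ∷_) (points ps)

  points-collinear : ∃[ L ] All (λ P → P I L) (pointsOf S)
  points-collinear = L₀ 0# , subst (All (λ P → P I L₀ 0#)) (sym pointsOf-S) (Allₚ.map⁺ (All.tabulate λ {t} _ → onL₀-on-L₀0 t))
    where
    onL₀-on-L₀0 : ∀ t → onL₀ t I L₀ 0#
    onL₀-on-L₀0 t = 1# , t , λ
      { 0F → sym (trans (lin-0ʳ 1# t 1#) (*-identityˡ 1#))
      ; 1F → sym (trans (lin-0ʳ 1# t 0#) (zeroʳ 1#))
      ; 2F → sym (trans (lin-0ˡ 1# t 1#) (*-identityʳ t))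
      ; 3F → sym (trans (lin-0ˡ 1# t 0#) (zeroʳ t)) }

  private
    2≢1 : 2# ≢ 1#
    2≢1 2≡1 = 1≢0 (+-cancelʳ 1# 1# 0# (trans 2≡1 (sym (+-identityˡ 1#))))

    |nonzero| : suc (length nonzero) ≡ length elements
    |nonzero| = length-without elements-unique (elements-complete 0#)

    |parameters| : suc (suc (length parameters)) ≡ length nonzero
    |parameters| = trans
      (cong suc (length-without (without-unique nonzero-unique) (∈-without⁺ (∈-without⁺ (elements-complete 2#) 2≢0) 2≢1)))
      (length-without nonzero-unique (∈-without⁺ (elements-complete 1#) 1≢0))

    q≡3+n : length elements ≡ 3 ℕ.+ length parameters
    q≡3+n = sym (trans (cong suc |parameters|) |nonzero|)

  |pointsOf-S| : length (pointsOf S) ≡ length elements ∸ 3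
  |pointsOf-S| = begin
    length (pointsOf S)                   ≡⟨ cong length pointsOf-S ⟩
    length (map onL₀ parameters)          ≡⟨ length-map onL₀ parameters ⟩
    length parameters                     ≡⟨ sym (ℕₚ.m+n∸m≡n 3 (length parameters)) ⟩
    3 ℕ.+ length parameters ∸ 3           ≡⟨ cong (_∸ 3) (sym q≡3+n) ⟩
    length elements ∸ 3                   ∎
    where open ≡-Reasoning

  |S| : length S ≡ 5 ℕ.* length elements ∸ 4
  |S| = begin
    length S                                              ≡⟨ length-++ (map inj₂ configurationLines) ⟩
    length (map inj₂ configurationLines) ℕ.+ length (map inj₁ configurationPoints)
      ≡⟨ cong₂ ℕ._+_ (length-map inj₂ configurationLines) (trans (length-map inj₁ configurationPoints) (length-map onL₀ parameters)) ⟩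
    length configurationLines ℕ.+ n
      ≡⟨ cong (ℕ._+ n) (trans (length-++ (map L₀ elements)) (cong₂ ℕ._+_ (length-map L₀ elements)
           (trans (length-++ (map L₂ elements)) (cong₂ ℕ._+_ (length-map L₂ elements)
             (trans (length-++ (map Lʸ elements)) (cong₂ ℕ._+_ (length-map Lʸ elements) (length-map L₁ nonzero))))))) ⟩
    (q ℕ.+ (q ℕ.+ (q ℕ.+ length nonzero))) ℕ.+ n         ≡⟨ cong₂ (λ q m → (q ℕ.+ (q ℕ.+ (q ℕ.+ m))) ℕ.+ n) q≡3+n (sym |parameters|) ⟩
    (3 ℕ.+ n ℕ.+ (3 ℕ.+ n ℕ.+ (3 ℕ.+ n ℕ.+ (2 ℕ.+ n)))) ℕ.+ n  ≡⟨ arithmetic n ⟩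
    5 ℕ.* (3 ℕ.+ n) ∸ 4                                   ≡⟨ cong (λ q → 5 ℕ.* q ∸ 4) (sym q≡3+n) ⟩
    5 ℕ.* q ∸ 4                                           ∎
    where
    open ≡-Reasoning
    q n : ℕ
    q = length elements
    n = length parameters
    arithmetic : ∀ n → (3 ℕ.+ n ℕ.+ (3 ℕ.+ n ℕ.+ (3 ℕ.+ n ℕ.+ (2 ℕ.+ n)))) ℕ.+ n ≡ 5 ℕ.* (3 ℕ.+ n) ∸ 4
    arithmetic n = trans (lhs n) (sym (trans (cong (_∸ 4) (rhs n)) (ℕₚ.m+n∸m≡n 4 (5 ℕ.* n ℕ.+ 11))))
      where
      lhs : ∀ n → (3 ℕ.+ n ℕ.+ (3 ℕ.+ n ℕ.+ (3 ℕ.+ n ℕ.+ (2 ℕ.+ n)))) ℕ.+ n ≡ 5 ℕ.* n ℕ.+ 11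
      lhs = solve-∀
      rhs : ∀ n → 5 ℕ.* (3 ℕ.+ n) ≡ 4 ℕ.+ (5 ℕ.* n ℕ.+ 11)
      rhs = solve-∀

open import Data.Nat using (_*_)

mainTheorem19 : (q : ℕ) → OddPrimePower q → (F : FiniteField) → FiniteField.order F ≡ q →
    let open W F in
    ∃[ S ] (Distinct S × SemiResolvingForLines S × length S ≡ 5 * q ∸ 4
            × length (pointsOf S) ≡ q ∸ 3
            × ∃[ L ] All (λ P → P I L) (pointsOf S))
mainTheorem19 q odd F refl =
  S , distinct , semiResolving , |S| , |pointsOf-S| , points-collinear
  where open Construction F (FieldTheory.odd-order⇒2≢0 F odd)
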